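{- Let $n,n'\ge 2$ be integers and let $G$ be the Cayley graph of the Coxeter system $\mathbf{I_2}(n)$ or of $\mathbf{I_2}(n)\times\mathbf{I_2}(n')$. Then $\sigma(G)=\lceil\sqrt{\kappa(G)}\rceil$.
   Context: $\mathbf{I_2}(m)$ is the Coxeter system $(\langle s,t\mid s^2=t^2=(st)^m=1\rangle,\{s,t\})$, whose Cayley graph is the cycle $C_{2m}$. The product of Coxeter systems $(W,S)$, $(W',S')$ is $(W\times W',S\times\{e'\}\cup\{e\}\times S')$; the Cayley graph of $\mathbf{I_2}(n)\times\mathbf{I_2}(n')$ is $C_{2n}\square C_{2n'}$. The Cayley graph of $(W,S)$ has $x\sim y$ iff $x^{ -1}y\in S$. $\kappa(G)$ is the largest $d$ with $Q_d$ a subgraph of $G$; $\sigma(G)$ is the minimum of the maximum degree of $G[K]$ over vertex sets $K$ with $|K|>\alpha(G)$. -}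

module Defs where

open import Data.Bool using (Bool; true; false; _∨_; _∧_; not; if_then_else_; T)
open import Data.Nat using (ℕ; zero; suc; _*_; _≤_; _<_; _⊔_; _≡ᵇ_)
open import Data.Fin using (Fin; toℕ; remQuot)
open import Data.Fin.Subset using (Subset; _∈_; _∩_; ∣_∣)
open import Data.Vec using (Vec; tabulate; lookup; foldr; _[_]%=_)
open import Data.Product using (Σ; ∃; _×_; _,_; proj₁; proj₂)
open import Data.Empty using (⊥)
open import Function.Definitions using (Injective)
open import Relation.Binary.PropositionalEquality using (_≡_)

record Graph : Set where
  field
    N   : ℕ
    adj : Fin N → Fin N → Bool
open Graph public

_⊢_~_ : (G : Graph) → Fin (N G) → Fin (N G) → Set
G ⊢ x ~ y = T (adj G x y)

-- The cycle C_m on vertices 0,…,m-1 (i ~ i+1 mod m).  Used for m ≥ 4.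
cycleAdj : (m : ℕ) → Fin m → Fin m → Bool
cycleAdj m i j =
  (suc (toℕ i) ≡ᵇ toℕ j) ∨ (suc (toℕ j) ≡ᵇ toℕ i)
  ∨ ((toℕ i ≡ᵇ 0) ∧ (suc (toℕ j) ≡ᵇ m))
  ∨ ((toℕ j ≡ᵇ 0) ∧ (suc (toℕ i) ≡ᵇ m))

Cycle : ℕ → Graph
Cycle m = record { N = m ; adj = cycleAdj m }

_□_ : Graph → Graph → Graph
G □ H = record { N = N G * N H ; adj = pa }
  where
    pa : Fin (N G * N H) → Fin (N G * N H) → Bool
    pa x y with remQuot (N H) x | remQuot (N H) y
    ... | (a , b) | (a' , b') =
      ((toℕ a ≡ᵇ toℕ a') ∧ adj H b b') ∨ ((toℕ b ≡ᵇ toℕ b') ∧ adj G a a')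

CayleyI2 : ℕ → Graph
CayleyI2 m = Cycle (2 * m)

CayleyI2×I2 : ℕ → ℕ → Graph
CayleyI2×I2 m m' = CayleyI2 m □ CayleyI2 m'

Independent : (G : Graph) → Subset (N G) → Set
Independent G K = ∀ u v → u ∈ K → v ∈ K → ¬' (G ⊢ u ~ v)
  where ¬' : Set → Set
        ¬' P = P → ⊥

IsAlpha : (G : Graph) → ℕ → Set
IsAlpha G a =
  (∃ λ K → Independent G K × ∣ K ∣ ≡ a) ×
  (∀ K → Independent G K → ∣ K ∣ ≤ a)

neighbours : (G : Graph) → Fin (N G) → Subset (N G)
neighbours G v = tabulate (adj G v)

degIn : (G : Graph) → Subset (N G) → Fin (N G) → ℕ
degIn G K v = ∣ K ∩ neighbours G v ∣

-- maximum degree of the induced subgraph G[K] (0 if K is empty)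
maxDeg : (G : Graph) → Subset (N G) → ℕ
maxDeg G K = foldr (λ _ → ℕ) _⊔_ 0
  (tabulate λ v → if lookup K v then degIn G K v else 0)

IsSigma : Graph → ℕ → Set
IsSigma G s = ∃ λ a → IsAlpha G a ×
  (∃ λ K → a < ∣ K ∣ × maxDeg G K ≡ s) ×
  (∀ K → a < ∣ K ∣ → s ≤ maxDeg G K)

-- Q_d : vertices Vec Bool d, u ~ v iff they differ in exactly one coordinate
flipAt : ∀ {d} → Vec Bool d → Fin d → Vec Bool d
flipAt u i = u [ i ]%= not

CubeSubgraph : ℕ → Graph → Set
CubeSubgraph d G = Σ (Vec Bool d → Fin (N G)) λ f →
  Injective _≡_ _≡_ f × (∀ u i → G ⊢ f u ~ f (flipAt u i))

IsKappa : Graph → ℕ → Set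
IsKappa G k = CubeSubgraph k G × (∀ d → CubeSubgraph d G → d ≤ k)

IsCeilSqrt : ℕ → ℕ → Set
IsCeilSqrt k s = k ≤ s * s × (∀ t → k ≤ t * t → s ≤ t)

-- Both graphs have a perfect matching and a proper 2-colouring, so α is half the number of
-- vertices and every larger set contains an edge, whence σ ≥ 1.  In the torus the matchings
-- along the two factors commute and cut the graph into disjoint 4-cycles; a set with more than
-- half of the vertices meets one of them in three vertices, whence σ ≥ 2 (likewise in C₄ = Q₂).
-- A cube in G is read off at one vertex through the directions of its edges there.  Any two of
-- them span a 4-cycle, and a cycle of length greater than 4 has no 4-cycle through both of its
-- directions at a vertex, so a long cycle contributes one direction and C₄ two; products of
-- cubes in the factors attain these counts.  Hence κ is 1 or 2 for cycles and 2, 3 or 4 for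
-- tori, and ⌈√κ⌉ is 1 exactly for the long cycles.  Explicit sets of α + 1 vertices with
-- maximum degree ⌈√κ⌉ make the lower bounds on σ sharp.

module Submission where

open import Defs
open import Data.Bool using (Bool; true; false; not; _∧_; _∨_; _xor_; T; if_then_else_)
open import Data.Bool.Properties
  using (not-¬; not-involutive; not-distribˡ-xor; not-distribʳ-xor; xor-identityʳ; T-≡; T-∨; T-∧)
open import Data.Nat using (ℕ; zero; suc; _+_; _*_; _≤_; _<_; _⊔_; _≡ᵇ_; z≤n; s≤s)
open import Data.Nat.Properties
open import Data.Fin as Fin using (Fin; zero; suc; toℕ; remQuot; combine; splitAt; join; _↑ˡ_; _↑ʳ_)
import Data.Fin.Properties as FinP
open import Data.Fin.Permutation using (permutation)
open import Data.Fin.Patterns using (0F; 1F; 2F; 3F)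
open import Data.Fin.Subset using (Subset; _∈_; ∣_∣)
open import Data.Fin.Subset.Properties using (p⊆q⇒∣p∣≤∣q∣; ∣⁅x⁆∣≡1; x∈⁅y⁆⇒x≡y; x∈p∩q⁺; x∈p∩q⁻)
open import Data.List as List using (List; []; _∷_)
open import Data.Vec as Vec using (Vec; []; _∷_; lookup; tabulate)
open import Data.Vec.Properties
  using (take++drop≡id; lookup∘tabulate; []=⇒lookup; lookup⇒[]=; lookup∘updateAt; lookup∘updateAt′; updateAt-commutes)
open import Data.Product using (Σ; ∃; _×_; _,_; proj₁; proj₂)
open import Data.Sum using (_⊎_; inj₁; inj₂)
import Data.Sum
open import Data.Sum.Properties using (inj₁-injective; inj₂-injective)
open import Data.Empty using (⊥; ⊥-elim)
open import Data.Unit using (tt)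
open import Function using (_∘_; Equivalence)
import Function
open import Relation.Nullary using (¬_; Dec; yes; no; does; contradiction)
open import Relation.Nullary.Decidable using (True; isYes; toWitness; fromWitness)
open import Relation.Binary.PropositionalEquality
open import Algebra.Properties.CommutativeMonoid.Sum +-0-commutativeMonoid
  using (sum; sum-cong-≗; ∑-distrib-+; ∑-comm; sum-permute)

private
  variable
    n k : ℕ

by-decide : ∀ {m n} {m≤n : True (m ≤? n)} → m ≤ n
by-decide {m≤n = m≤n} = toWitness m≤n

not-≢-self : ∀ b → not b ≢ b
not-≢-self b = not-¬ refl ∘ sym

T-∨ˡ : ∀ x {y} → T x → T (x ∨ y)
T-∨ˡ _ = Equivalence.from T-∨ ∘ inj₁

T-∨ʳ : ∀ x {y} → T y → T (x ∨ y)
T-∨ʳ _ = Equivalence.from T-∨ ∘ inj₂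

T-∧⁺ : ∀ {x y} → T x → T y → T (x ∧ y)
T-∧⁺ {true} _ t = t

𝟙 : Bool → ℕ
𝟙 true  = 1
𝟙 false = 0

AtMostOne : (Fin n → Bool) → Set
AtMostOne Q = ∀ x y → T (Q x) → T (Q y) → x ≡ y

1<𝟙+𝟙⇒both : ∀ {a b} → 1 < 𝟙 a + 𝟙 b → a ≡ true × b ≡ true
1<𝟙+𝟙⇒both {true}  {true}  _         = refl , refl
1<𝟙+𝟙⇒both {true}  {false} (s≤s ())
1<𝟙+𝟙⇒both {false} {true}  (s≤s ())
1<𝟙+𝟙⇒both {false} {false} ()

∣p∣≡∑𝟙 : (p : Subset n) → ∣ p ∣ ≡ sum (𝟙 ∘ lookup p)
∣p∣≡∑𝟙 []          = refl
∣p∣≡∑𝟙 (true ∷ p)  = cong suc (∣p∣≡∑𝟙 p)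
∣p∣≡∑𝟙 (false ∷ p) = ∣p∣≡∑𝟙 p

sum-mono-≤ : {f g : Fin n → ℕ} → (∀ x → f x ≤ g x) → sum f ≤ sum g
sum-mono-≤ {zero}  f≤g = z≤n
sum-mono-≤ {suc n} f≤g = +-mono-≤ (f≤g zero) (sum-mono-≤ (f≤g ∘ suc))

sum-const : ∀ n c → sum {n} (λ _ → c) ≡ n * c
sum-const zero    c = refl
sum-const (suc n) c = cong (c +_) (sum-const n c)

sum-∘-involution : (ρ : Fin n → Fin n) → (∀ x → ρ (ρ x) ≡ x) →
                   (f : Fin n → ℕ) → sum (f ∘ ρ) ≡ sum f
sum-∘-involution ρ inv f = sym (sum-permute f (permutation ρ ρ inv inv))

sum>*⇒∃> : (f : Fin n → ℕ) (c : ℕ) → n * c < sum f → ∃ λ x → c < f x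
sum>*⇒∃> {suc n} f c lt with c <? f zero
... | yes c<f0 = zero , c<f0
... | no  c≮f0 =
  let x , c<fx = sum>*⇒∃> (f ∘ suc) c
                   (+-cancelˡ-< c _ _ (<-≤-trans lt (+-monoˡ-≤ _ (≮⇒≥ c≮f0))))
  in suc x , c<fx

∑𝟙≤1 : (Q : Fin n → Bool) → AtMostOne Q → sum (𝟙 ∘ Q) ≤ 1
∑𝟙≤1 {zero}  Q unique = z≤n
∑𝟙≤1 {suc n} Q unique with Q zero in Q0
... | false = ∑𝟙≤1 (Q ∘ suc) λ x y Qx Qy → FinP.suc-injective (unique _ _ Qx Qy)
... | true  = ≤-reflexive (cong suc (trans (sum-cong-≗ rest≡0) (trans (sum-const n 0) (*-zeroʳ n))))
  where
  rest≡0 : ∀ x → 𝟙 (Q (suc x)) ≡ 0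
  rest≡0 x with Q (suc x) in Qx
  ... | false = refl
  ... | true  with () ← unique zero (suc x) (subst T (sym Q0) tt) (subst T (sym Qx) tt)

∑𝟙≟ : (x : Fin n) → sum (λ v → 𝟙 (does (v Fin.≟ x))) ≡ 1
∑𝟙≟ {suc n} zero    = cong suc (trans (sum-const n 0) (*-zeroʳ n))
∑𝟙≟ {suc n} (suc x) = trans (sum-cong-≗ (cong 𝟙 ∘ ≟-suc)) (∑𝟙≟ x)
  where
  ≟-suc : ∀ y → does (suc y Fin.≟ suc x) ≡ does (y Fin.≟ x)
  ≟-suc y with y Fin.≟ x
  ... | yes refl = refl
  ... | no  _    = refl

f≤sum : (f : Fin n → ℕ) (i : Fin n) → f i ≤ sum f
f≤sum f zero    = m≤m+n _ _
f≤sum f (suc i) = ≤-trans (f≤sum (f ∘ suc) i) (m≤n+m _ _)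

module _ {p : Subset n} where

  ∈⇒1≤∣p∣ : ∀ {x} → x ∈ p → 1 ≤ ∣ p ∣
  ∈⇒1≤∣p∣ {x} x∈p = subst (_≤ ∣ p ∣) (∣⁅x⁆∣≡1 x)
    (p⊆q⇒∣p∣≤∣q∣ λ y∈⁅x⁆ → subst (_∈ p) (sym (x∈⁅y⁆⇒x≡y x y∈⁅x⁆)) x∈p)

  ∈∈⇒2≤∣p∣ : ∀ {x y} → x ∈ p → y ∈ p → x ≢ y → 2 ≤ ∣ p ∣
  ∈∈⇒2≤∣p∣ {x} {y} x∈p y∈p x≢y = begin
    2                                 ≡⟨ cong₂ _+_ (∑𝟙≟ x) (∑𝟙≟ y) ⟨
    sum (δ x) + sum (δ y)             ≡⟨ ∑-distrib-+ (δ x) (δ y) ⟨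
    sum (λ v → δ x v + δ y v)         ≤⟨ sum-mono-≤ δx+δy≤p ⟩
    sum (𝟙 ∘ lookup p)                ≡⟨ ∣p∣≡∑𝟙 p ⟨
    ∣ p ∣                             ∎
    where
    open ≤-Reasoning
    δ : Fin n → Fin n → ℕ
    δ z v = 𝟙 (does (v Fin.≟ z))
    δx+δy≤p : ∀ v → δ x v + δ y v ≤ 𝟙 (lookup p v)
    δx+δy≤p v with v Fin.≟ x | v Fin.≟ y
    ... | yes refl | yes refl = ⊥-elim (x≢y refl)
    ... | yes refl | no  _    = ≤-reflexive (cong 𝟙 (sym ([]=⇒lookup x∈p)))
    ... | no  _    | yes refl = ≤-reflexive (cong 𝟙 (sym ([]=⇒lookup y∈p)))
    ... | no  _    | no  _    = z≤n

  ∣p∣≤cover : (Q : Fin k → Fin n → Bool) → (∀ i → AtMostOne (Q i)) →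
              (∀ v → v ∈ p → ∃ λ i → T (Q i v)) → ∣ p ∣ ≤ k
  ∣p∣≤cover {k} Q unique cover = begin
    ∣ p ∣                               ≡⟨ ∣p∣≡∑𝟙 p ⟩
    sum (𝟙 ∘ lookup p)                  ≤⟨ sum-mono-≤ p≤∑Q ⟩
    sum (λ v → sum λ i → 𝟙 (Q i v))     ≡⟨ ∑-comm (λ v i → 𝟙 (Q i v)) ⟩
    sum (λ i → sum λ v → 𝟙 (Q i v))     ≤⟨ sum-mono-≤ (λ i → ∑𝟙≤1 (Q i) (unique i)) ⟩
    sum {k} (λ _ → 1)                   ≡⟨ trans (sum-const k 1) (*-identityʳ k) ⟩
    k                                   ∎
    where
    open ≤-Reasoning
    p≤∑Q : ∀ v → 𝟙 (lookup p v) ≤ sum λ i → 𝟙 (Q i v)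
    p≤∑Q v with lookup p v in pv
    ... | false = z≤n
    ... | true  = let i , Qiv = cover v (lookup⇒[]= _ _ pv) in
                  ≤-trans (≤-reflexive (cong 𝟙 (sym (Equivalence.to T-≡ Qiv))))
                          (f≤sum (λ i → 𝟙 (Q i v)) i)

module _ (G : Graph) where

  private
    V : Set
    V = Fin (N G)

  ~⇒∈neighbours : ∀ {v w} → G ⊢ v ~ w → w ∈ neighbours G v
  ~⇒∈neighbours {v} {w} v~w = lookup⇒[]= _ _ (trans (lookup∘tabulate (adj G v) w) (Equivalence.to T-≡ v~w))

  ∈neighbours⇒~ : ∀ {v w} → w ∈ neighbours G v → G ⊢ v ~ w
  ∈neighbours⇒~ {v} {w} w∈ = subst T (sym (trans (sym (lookup∘tabulate (adj G v) w)) ([]=⇒lookup w∈))) tt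

  module _ {K : Subset (N G)} {v : V} where

    degIn≥1 : ∀ {w} → w ∈ K → G ⊢ v ~ w → 1 ≤ degIn G K v
    degIn≥1 w∈K v~w = ∈⇒1≤∣p∣ (x∈p∩q⁺ (w∈K , ~⇒∈neighbours v~w))

    degIn≥2 : ∀ {w w′} → w ∈ K → G ⊢ v ~ w → w′ ∈ K → G ⊢ v ~ w′ → w ≢ w′ → 2 ≤ degIn G K v
    degIn≥2 w∈K v~w w′∈K v~w′ =
      ∈∈⇒2≤∣p∣ (x∈p∩q⁺ (w∈K , ~⇒∈neighbours v~w)) (x∈p∩q⁺ (w′∈K , ~⇒∈neighbours v~w′))

    degIn≤cover : (Q : Fin k → V → Bool) → (∀ i → AtMostOne (Q i)) →
                  (∀ w → w ∈ K → G ⊢ v ~ w → ∃ λ i → T (Q i w)) → degIn G K v ≤ k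
    degIn≤cover Q unique cover = ∣p∣≤cover Q unique λ w w∈ →
      let w∈K , w∈nbrs = x∈p∩q⁻ K (neighbours G v) w∈ in cover w w∈K (∈neighbours⇒~ w∈nbrs)

    degIn≤1 : (∀ {w w′} → w ∈ K → w′ ∈ K → G ⊢ v ~ w → G ⊢ v ~ w′ → w ≡ w′) →
              degIn G K v ≤ 1
    degIn≤1 unique = degIn≤cover (λ _ w → lookup K w ∧ adj G v w)
      (λ _ w w′ Kw∧v~w Kw′∧v~w′ →
        let Kw , v~w = Equivalence.to T-∧ Kw∧v~w ; Kw′ , v~w′ = Equivalence.to T-∧ Kw′∧v~w′ in
        unique (lookup⇒[]= _ _ (Equivalence.to T-≡ Kw)) (lookup⇒[]= _ _ (Equivalence.to T-≡ Kw′)) v~w v~w′)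
      (λ w w∈K v~w → zero , T-∧⁺ (subst T (sym ([]=⇒lookup w∈K)) tt) v~w)

  private
    max : ∀ {m} → (Fin m → ℕ) → ℕ
    max g = Vec.foldr (λ _ → ℕ) _⊔_ 0 (tabulate g)

    ≤max : ∀ {m} (g : Fin m → ℕ) v → g v ≤ max g
    ≤max g zero    = m≤m⊔n _ _
    ≤max g (suc v) = ≤-trans (≤max (g ∘ suc) v) (m≤n⊔m (g zero) _)

    max≤ : ∀ {m} (g : Fin m → ℕ) {s} → (∀ v → g v ≤ s) → max g ≤ s
    max≤ {zero}  g g≤s = z≤n
    max≤ {suc m} g g≤s = ⊔-lub (g≤s zero) (max≤ (g ∘ suc) (g≤s ∘ suc))

  module _ {K : Subset (N G)} where

    degIn≤maxDeg : ∀ {v} → v ∈ K → degIn G K v ≤ maxDeg G K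
    degIn≤maxDeg {v} v∈K =
      subst (λ b → (if b then degIn G K v else 0) ≤ maxDeg G K) ([]=⇒lookup v∈K)
        (≤max (λ v → if lookup K v then degIn G K v else 0) v)

    maxDeg≤ : ∀ {s} → (∀ v → v ∈ K → degIn G K v ≤ s) → maxDeg G K ≤ s
    maxDeg≤ {s} deg≤s = max≤ _ λ v → bound v (lookup K v) refl
      where
      bound : ∀ v b → lookup K v ≡ b → (if b then degIn G K v else 0) ≤ s
      bound v true  Kv = deg≤s v (lookup⇒[]= _ _ Kv)
      bound v false _  = z≤n

    edge⇒1≤maxDeg : ∀ {v w} → v ∈ K → w ∈ K → G ⊢ v ~ w → 1 ≤ maxDeg G K
    edge⇒1≤maxDeg v∈K w∈K v~w = ≤-trans (degIn≥1 w∈K v~w) (degIn≤maxDeg v∈K)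

    path⇒2≤maxDeg : ∀ {v w w′} → v ∈ K → w ∈ K → w′ ∈ K →
                    G ⊢ v ~ w → G ⊢ v ~ w′ → w ≢ w′ → 2 ≤ maxDeg G K
    path⇒2≤maxDeg v∈K w∈K w′∈K v~w v~w′ w≢w′ =
      ≤-trans (degIn≥2 w∈K v~w w′∈K v~w′ w≢w′) (degIn≤maxDeg v∈K)

-- Proper colourings and perfect matchings

record PerfectMatching (G : Graph) : Set where
  field
    mate            : Fin (N G) → Fin (N G)
    mate-involutive : ∀ x → mate (mate x) ≡ x
    ~mate           : ∀ x → G ⊢ x ~ mate x
    mate-≢          : ∀ x → mate x ≢ x

ProperColouring : (G : Graph) → (Fin (N G) → Bool) → Set
ProperColouring G χ = ∀ x y → G ⊢ x ~ y → χ y ≡ not (χ x)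

module _ {G : Graph} {χ : Fin (N G) → Bool} (proper : ProperColouring G χ) where

  colour-class-independent : Independent G (tabulate χ)
  colour-class-independent x y x∈ y∈ x~y = contradiction true≡false λ ()
    where
    open ≡-Reasoning
    true≡false : true ≡ false
    true≡false = begin
      true                   ≡⟨ []=⇒lookup y∈ ⟨
      lookup (tabulate χ) y  ≡⟨ lookup∘tabulate χ y ⟩
      χ y                    ≡⟨ proper x y x~y ⟩
      not (χ x)              ≡⟨ cong not (trans (sym (lookup∘tabulate χ x)) ([]=⇒lookup x∈)) ⟩
      false                  ∎

  not-colouring : ProperColouring G (not ∘ χ)
  not-colouring x y x~y = cong not (proper x y x~y)

module PerfectMatchingProperties {G : Graph} (M : PerfectMatching G) where

  open PerfectMatching M

  pairCount : Subset (N G) → Fin (N G) → ℕ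
  pairCount K x = 𝟙 (lookup K x) + 𝟙 (lookup K (mate x))

  2*∣K∣≡∑pairCount : (K : Subset (N G)) → 2 * ∣ K ∣ ≡ sum (pairCount K)
  2*∣K∣≡∑pairCount K = begin
    2 * ∣ K ∣                                       ≡⟨ cong (∣ K ∣ +_) (+-identityʳ ∣ K ∣) ⟩
    ∣ K ∣ + ∣ K ∣                                   ≡⟨ cong₂ _+_ (∣p∣≡∑𝟙 K) (∣p∣≡∑𝟙 K) ⟩
    sum (𝟙 ∘ lookup K) + sum (𝟙 ∘ lookup K)         ≡⟨ cong (_ +_) (sum-∘-involution mate mate-involutive _) ⟨
    sum (𝟙 ∘ lookup K) + sum (𝟙 ∘ lookup K ∘ mate)  ≡⟨ ∑-distrib-+ (𝟙 ∘ lookup K) (𝟙 ∘ lookup K ∘ mate) ⟨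
    sum (pairCount K)                               ∎
    where open ≡-Reasoning

  N≡∑1 : N G ≡ sum {N G} (λ _ → 1)
  N≡∑1 = sym (trans (sum-const (N G) 1) (*-identityʳ (N G)))

  independent⇒2*∣K∣≤N : ∀ K → Independent G K → 2 * ∣ K ∣ ≤ N G
  independent⇒2*∣K∣≤N K indep =
    subst₂ _≤_ (sym (2*∣K∣≡∑pairCount K)) (sym N≡∑1) (sum-mono-≤ pairCount≤1)
    where
    pairCount≤1 : ∀ x → pairCount K x ≤ 1
    pairCount≤1 x with lookup K x in Kx | lookup K (mate x) in Kmx
    ... | true  | true  = ⊥-elim (indep x (mate x) (lookup⇒[]= _ _ Kx) (lookup⇒[]= _ _ Kmx) (~mate x))
    ... | true  | false = ≤-refl
    ... | false | _     = 𝟙≤1 _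
      where
      𝟙≤1 : ∀ b → 𝟙 b ≤ 1
      𝟙≤1 true  = ≤-refl
      𝟙≤1 false = z≤n

  N<2*∣K∣⇒1≤maxDeg : ∀ K → N G < 2 * ∣ K ∣ → 1 ≤ maxDeg G K
  N<2*∣K∣⇒1≤maxDeg K N<2∣K∣ =
    let x , 1<pairCount = sum>*⇒∃> (pairCount K) 1
                            (subst₂ _<_ (sym (*-identityʳ (N G))) (2*∣K∣≡∑pairCount K) N<2∣K∣)
        Kx , Kmx        = 1<𝟙+𝟙⇒both {lookup K x} 1<pairCount
    in edge⇒1≤maxDeg G {K = K} (lookup⇒[]= _ _ Kx) (lookup⇒[]= _ _ Kmx) (~mate x)

  meets-every-pair⇒N<2*∣K∣ : ∀ K → (∀ x → x ∈ K ⊎ mate x ∈ K) →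
                             ∀ {x₀} → x₀ ∈ K → mate x₀ ∈ K → N G < 2 * ∣ K ∣
  meets-every-pair⇒N<2*∣K∣ K meets {x₀} x₀∈K mx₀∈K = begin-strict
    N G                                        ≡⟨ N≡∑1 ⟩
    sum {N G} (λ _ → 1)                        <⟨ m<m+n _ (≤-reflexive (sym (∑𝟙≟ x₀))) ⟩
    sum {N G} (λ _ → 1) + sum (δ x₀)          ≡⟨ ∑-distrib-+ (λ _ → 1) (δ x₀) ⟨
    sum (λ x → 1 + δ x₀ x)                     ≤⟨ sum-mono-≤ 1+δ≤pairCount ⟩
    sum (pairCount K)                          ≡⟨ 2*∣K∣≡∑pairCount K ⟨
    2 * ∣ K ∣                                  ∎
    where
    open ≤-Reasoning
    δ : Fin (N G) → Fin (N G) → ℕ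
    δ z x = 𝟙 (does (x Fin.≟ z))
    1+δ≤pairCount : ∀ x → 1 + δ x₀ x ≤ pairCount K x
    1+δ≤pairCount x with x Fin.≟ x₀
    ... | yes refl rewrite []=⇒lookup x₀∈K | []=⇒lookup mx₀∈K = ≤-refl
    ... | no _ with meets x
    ...   | inj₁ x∈K  rewrite []=⇒lookup x∈K  = s≤s z≤n
    ...   | inj₂ mx∈K rewrite []=⇒lookup mx∈K = m≤n+m 1 _

  2*∣colour-class∣≡N : ∀ {χ} → ProperColouring G χ → 2 * ∣ tabulate χ ∣ ≡ N G
  2*∣colour-class∣≡N {χ} proper =
    trans (2*∣K∣≡∑pairCount (tabulate χ)) (trans (sum-cong-≗ pair≡1) (sym N≡∑1))
    where
    𝟙b+𝟙¬b : ∀ b → 𝟙 b + 𝟙 (not b) ≡ 1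
    𝟙b+𝟙¬b true  = refl
    𝟙b+𝟙¬b false = refl
    pair≡1 : ∀ x → pairCount (tabulate χ) x ≡ 1
    pair≡1 x rewrite lookup∘tabulate χ x | lookup∘tabulate χ (mate x) | proper x (mate x) (~mate x) =
      𝟙b+𝟙¬b (χ x)

  colouring⇒IsAlpha : ∀ {χ a} → ProperColouring G χ → N G ≡ 2 * a → IsAlpha G a
  colouring⇒IsAlpha {χ} {a} proper N≡2a =
    (tabulate χ , colour-class-independent proper ,
     *-cancelˡ-≡ _ _ 2 (trans (2*∣colour-class∣≡N proper) N≡2a)) ,
    λ K indep → *-cancelˡ-≤ 2 (subst (2 * ∣ K ∣ ≤_) N≡2a (independent⇒2*∣K∣≤N K indep))

private
  2<𝟙+𝟙+𝟙+𝟙 : ∀ a b c d → 2 < 𝟙 a + 𝟙 b + (𝟙 c + 𝟙 d) →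
    (a ≡ true × b ≡ true × c ≡ true) ⊎ (a ≡ true × b ≡ true × d ≡ true) ⊎
    (a ≡ true × c ≡ true × d ≡ true) ⊎ (b ≡ true × c ≡ true × d ≡ true)
  2<𝟙+𝟙+𝟙+𝟙 true  true  true  _     _ = inj₁ (refl , refl , refl)
  2<𝟙+𝟙+𝟙+𝟙 true  true  false true  _ = inj₂ (inj₁ (refl , refl , refl))
  2<𝟙+𝟙+𝟙+𝟙 true  false true  true  _ = inj₂ (inj₂ (inj₁ (refl , refl , refl)))
  2<𝟙+𝟙+𝟙+𝟙 false true  true  true  _ = inj₂ (inj₂ (inj₂ (refl , refl , refl)))
  2<𝟙+𝟙+𝟙+𝟙 true  true  false false (s≤s (s≤s ()))
  2<𝟙+𝟙+𝟙+𝟙 true  false true  false (s≤s (s≤s ()))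
  2<𝟙+𝟙+𝟙+𝟙 true  false false true  (s≤s (s≤s ()))
  2<𝟙+𝟙+𝟙+𝟙 false true  true  false (s≤s (s≤s ()))
  2<𝟙+𝟙+𝟙+𝟙 false true  false true  (s≤s (s≤s ()))
  2<𝟙+𝟙+𝟙+𝟙 false false true  true  (s≤s (s≤s ()))
  2<𝟙+𝟙+𝟙+𝟙 true  false false false (s≤s ())
  2<𝟙+𝟙+𝟙+𝟙 false true  false false (s≤s ())
  2<𝟙+𝟙+𝟙+𝟙 false false true  false (s≤s ())
  2<𝟙+𝟙+𝟙+𝟙 false false false true  (s≤s ())
  2<𝟙+𝟙+𝟙+𝟙 false false false false ()

-- Two commuting perfect matchings split G into disjoint 4-cycles x, h x, h (u x), u x;
-- a set with more than half of the vertices contains three vertices of one of them.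
module _ {G : Graph} (H U : PerfectMatching G) where

  open PerfectMatching H renaming (mate to h; mate-involutive to h-involutive; ~mate to ~h)
  open PerfectMatching U renaming (mate to u; mate-involutive to u-involutive; ~mate to ~u)
  open PerfectMatchingProperties H using (pairCount; 2*∣K∣≡∑pairCount)

  squares⇒2≤maxDeg : (∀ x → h (u x) ≡ u (h x)) → (∀ x → h x ≢ u x) → (∀ x → x ≢ h (u x)) →
                     ∀ K → N G < 2 * ∣ K ∣ → 2 ≤ maxDeg G K
  squares⇒2≤maxDeg hu≡uh h≢u x≢hu K N<2∣K∣ =
    three-in-a-square (sum>*⇒∃> square 2
      (subst₂ _<_ (*-comm 2 (N G)) (sym ∑square≡4∣K∣) (*-monoʳ-< 2 N<2∣K∣)))
    where
    square : Fin (N G) → ℕ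
    square x = pairCount K x + pairCount K (u x)

    ∑square≡4∣K∣ : sum square ≡ 2 * (2 * ∣ K ∣)
    ∑square≡4∣K∣ = begin
      sum square                                      ≡⟨ ∑-distrib-+ (pairCount K) (pairCount K ∘ u) ⟩
      sum (pairCount K) + sum (pairCount K ∘ u)       ≡⟨ cong (_ +_) (sum-∘-involution u u-involutive _) ⟩
      sum (pairCount K) + sum (pairCount K)           ≡⟨ cong₂ _+_ ∑pairCount≡ ∑pairCount≡ ⟩
      2 * ∣ K ∣ + 2 * ∣ K ∣                           ≡⟨ cong (2 * ∣ K ∣ +_) (+-identityʳ _) ⟨
      2 * (2 * ∣ K ∣)                                 ∎
      where
      open ≡-Reasoning
      ∑pairCount≡ : sum (pairCount K) ≡ 2 * ∣ K ∣
      ∑pairCount≡ = sym (2*∣K∣≡∑pairCount K)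

    centre : ∀ {v w w′} → lookup K v ≡ true → lookup K w ≡ true → lookup K w′ ≡ true →
             G ⊢ v ~ w → G ⊢ v ~ w′ → w ≢ w′ → 2 ≤ maxDeg G K
    centre Kv Kw Kw′ = path⇒2≤maxDeg G {K = K} (lookup⇒[]= _ _ Kv) (lookup⇒[]= _ _ Kw) (lookup⇒[]= _ _ Kw′)

    three-in-a-square : (∃ λ x → 2 < square x) → 2 ≤ maxDeg G K
    three-in-a-square (x , 2<square)
      with 2<𝟙+𝟙+𝟙+𝟙 (lookup K x) (lookup K (h x)) (lookup K (u x)) (lookup K (h (u x))) 2<square
    ... | inj₁ (Kx , Khx , Kux) =
      centre Kx Khx Kux (~h x) (~u x) (h≢u x)
    ... | inj₂ (inj₁ (Kx , Khx , Khux)) =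
      centre Khx Kx Khux (subst (G ⊢ h x ~_) (h-involutive x) (~h (h x)))
                         (subst (G ⊢ h x ~_) (sym (hu≡uh x)) (~u (h x))) (x≢hu x)
    ... | inj₂ (inj₂ (inj₁ (Kx , Kux , Khux))) =
      centre Kux Kx Khux (subst (G ⊢ u x ~_) (u-involutive x) (~u (u x))) (~h (u x)) (x≢hu x)
    ... | inj₂ (inj₂ (inj₂ (Khx , Kux , Khux))) =
      centre Khux Kux Khx (subst (G ⊢ h (u x) ~_) (h-involutive (u x)) (~h (h (u x))))
                          (subst (G ⊢ h (u x) ~_) u-h-u≡h (~u (h (u x)))) (h≢u x ∘ sym)
      where
      u-h-u≡h : u (h (u x)) ≡ h x
      u-h-u≡h = trans (sym (hu≡uh (u x))) (cong h (u-involutive x))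

-- Hypercubes

private
  variable
    d : ℕ

module _ {u : Vec Bool d} where

  flipAt-injective : ∀ {i j} → flipAt u i ≡ flipAt u j → i ≡ j
  flipAt-injective {i} {j} eq with i Fin.≟ j
  ... | yes i≡j = i≡j
  ... | no  i≢j = contradiction (begin
      not (lookup u i)          ≡⟨ lookup∘updateAt i u ⟨
      lookup (flipAt u i) i     ≡⟨ cong (λ v → lookup v i) eq ⟩
      lookup (flipAt u j) i     ≡⟨ lookup∘updateAt′ i j i≢j u ⟩
      lookup u i                ∎) (not-≢-self (lookup u i))
    where open ≡-Reasoning

  flipAt-flipAt≢ : ∀ {i j} → i ≢ j → flipAt (flipAt u i) j ≢ u
  flipAt-flipAt≢ {i} {j} i≢j eq = not-≢-self (lookup u i) (begin
    not (lookup u i)                  ≡⟨ lookup∘updateAt i u ⟨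
    lookup (flipAt u i) i             ≡⟨ lookup∘updateAt′ i j i≢j (flipAt u i) ⟨
    lookup (flipAt (flipAt u i) j) i  ≡⟨ cong (λ v → lookup v i) eq ⟩
    lookup u i                        ∎)
    where open ≡-Reasoning

  flipAt-comm : ∀ i j → flipAt (flipAt u i) j ≡ flipAt (flipAt u j) i
  flipAt-comm i j with i Fin.≟ j
  ... | yes refl = refl
  ... | no  i≢j  = updateAt-commutes j i (i≢j ∘ sym) u

module _ {e : ℕ} where

  take-flipAt-↑ˡ : ∀ d (u : Vec Bool (d + e)) i → Vec.take d (flipAt u (i ↑ˡ e)) ≡ flipAt (Vec.take d u) i
  take-flipAt-↑ˡ (suc d) (x ∷ u) zero    = refl
  take-flipAt-↑ˡ (suc d) (x ∷ u) (suc i) = cong (x ∷_) (take-flipAt-↑ˡ d u i)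

  drop-flipAt-↑ˡ : ∀ d (u : Vec Bool (d + e)) i → Vec.drop d (flipAt u (i ↑ˡ e)) ≡ Vec.drop d u
  drop-flipAt-↑ˡ (suc d) (x ∷ u) zero    = refl
  drop-flipAt-↑ˡ (suc d) (x ∷ u) (suc i) = drop-flipAt-↑ˡ d u i

  take-flipAt-↑ʳ : ∀ d (u : Vec Bool (d + e)) j → Vec.take d (flipAt u (d ↑ʳ j)) ≡ Vec.take d u
  take-flipAt-↑ʳ zero    u       j = refl
  take-flipAt-↑ʳ (suc d) (x ∷ u) j = cong (x ∷_) (take-flipAt-↑ʳ d u j)

  drop-flipAt-↑ʳ : ∀ d (u : Vec Bool (d + e)) j → Vec.drop d (flipAt u (d ↑ʳ j)) ≡ flipAt (Vec.drop d u) j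
  drop-flipAt-↑ʳ zero    u       j = refl
  drop-flipAt-↑ʳ (suc d) (x ∷ u) j = drop-flipAt-↑ʳ d u j

edge⇒cube : ∀ {G v w} → v ≢ w → G ⊢ v ~ w → G ⊢ w ~ v → CubeSubgraph 1 G
edge⇒cube {G} {v} {w} v≢w v~w w~v = f , f-injective , f-adjacent
  where
  f : Vec Bool 1 → Fin (N G)
  f (false ∷ []) = v
  f (true  ∷ []) = w

  f-injective : ∀ {x y} → f x ≡ f y → x ≡ y
  f-injective {false ∷ []} {false ∷ []} _   = refl
  f-injective {true  ∷ []} {true  ∷ []} _   = refl
  f-injective {false ∷ []} {true  ∷ []} v≡w = ⊥-elim (v≢w v≡w)
  f-injective {true  ∷ []} {false ∷ []} w≡v = ⊥-elim (v≢w (sym w≡v))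

  f-adjacent : ∀ x i → G ⊢ f x ~ f (flipAt x i)
  f-adjacent (false ∷ []) zero = v~w
  f-adjacent (true  ∷ []) zero = w~v

module CubeCorners {G : Graph} (cube : CubeSubgraph d G) where

  private
    f : Vec Bool d → Fin (N G)
    f = proj₁ cube

    f-injective : ∀ {u v} → f u ≡ f v → u ≡ v
    f-injective = proj₁ (proj₂ cube)

    f-adjacent : ∀ u i → G ⊢ f u ~ f (flipAt u i)
    f-adjacent = proj₂ (proj₂ cube)

    0⃗ : Vec Bool d
    0⃗ = Vec.replicate d false

  origin : Fin (N G)
  origin = f 0⃗

  corner : Fin d → Fin (N G)
  corner i = f (flipAt 0⃗ i)

  far : Fin d → Fin d → Fin (N G)
  far i j = f (flipAt (flipAt 0⃗ i) j)

  origin~corner : ∀ i → G ⊢ origin ~ corner i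
  origin~corner = f-adjacent 0⃗

  corner-injective : ∀ {i j} → corner i ≡ corner j → i ≡ j
  corner-injective = flipAt-injective ∘ f-injective

  corner~far : ∀ i j → G ⊢ corner i ~ far i j
  corner~far i = f-adjacent (flipAt 0⃗ i)

  corner~far′ : ∀ i j → G ⊢ corner j ~ far i j
  corner~far′ i j = subst (λ v → G ⊢ corner j ~ f v) (flipAt-comm j i) (f-adjacent (flipAt 0⃗ j) i)

  far≢origin : ∀ {i j} → i ≢ j → far i j ≢ origin
  far≢origin i≢j = flipAt-flipAt≢ i≢j ∘ f-injective

record Directions (G : Graph) (Δ : ℕ) : Set where
  field
    Towards  : Fin (N G) → Fin Δ → Fin (N G) → Bool
    unique   : ∀ v k → AtMostOne (Towards v k)
    covering : ∀ {v w} → G ⊢ v ~ w → ∃ λ k → T (Towards v k w)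

module _ {G : Graph} {Δ : ℕ} (D : Directions G Δ) where

  open Directions D

  degIn≤directions : ∀ {K v j} (ks : Fin j → Fin Δ) →
                     (∀ {w} k → w ∈ K → G ⊢ v ~ w → T (Towards v k w) → ∃ λ i → ks i ≡ k) →
                     degIn G K v ≤ j
  degIn≤directions {K} {v} ks open-only = degIn≤cover G {K = K} {v = v}
    (λ i → Towards v (ks i)) (λ i → unique v (ks i)) λ w w∈K v~w →
      let k , towards = covering v~w ; i , ks-i≡k = open-only k w∈K v~w towards in
      i , subst (λ k → T (Towards v k w)) (sym ks-i≡k) towards

collapse : Fin n → Fin 1
collapse _ = zero

module CubeDirections {G : Graph} {Δ : ℕ} (D : Directions G Δ) (cube : CubeSubgraph d G) where

  open Directions D
  open CubeCorners {G = G} cube public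

  direction : Fin d → Fin Δ
  direction i = proj₁ (covering (origin~corner i))

  towards-corner : ∀ i → T (Towards origin (direction i) (corner i))
  towards-corner i = proj₂ (covering (origin~corner i))

  direction-injective : ∀ {i j} → direction i ≡ direction j → i ≡ j
  direction-injective {i} {j} eq = corner-injective
    (unique origin (direction j) (corner i) (corner j)
       (subst (λ k → T (Towards origin k (corner i))) eq (towards-corner i)) (towards-corner j))

  dim≤ : ∀ {k} (merge : Fin Δ → Fin k) →
         (∀ i j → merge (direction i) ≡ merge (direction j) → direction i ≡ direction j) → d ≤ k
  dim≤ merge merge-injective = FinP.injective⇒≤ (direction-injective ∘ merge-injective _ _)

data CyclicSucc (m : ℕ) : ℕ → ℕ → Set where
  step : ∀ {i} → CyclicSucc m i (suc i)
  wrap : ∀ {i} → suc i ≡ m → CyclicSucc m i 0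

CyclicAdj : ℕ → ℕ → ℕ → Set
CyclicAdj m i j = CyclicSucc m i j ⊎ CyclicSucc m j i

module _ {m : ℕ} where

  CyclicSucc? : ∀ i j → Dec (CyclicSucc m i j)
  CyclicSucc? i j with j ≟ suc i
  ... | yes refl = yes step
  ... | no  j≢1+i with j ≟ 0 | suc i ≟ m
  ...   | yes refl | yes 1+i≡m = yes (wrap 1+i≡m)
  ...   | yes refl | no  1+i≢m = no λ { (wrap 1+i≡m) → 1+i≢m 1+i≡m }
  ...   | no  j≢0  | _         = no λ { step → j≢1+i refl ; (wrap _) → j≢0 refl }

  CyclicSucc-injective : ∀ {i j k} → CyclicSucc m i k → CyclicSucc m j k → i ≡ j
  CyclicSucc-injective step         step         = refl
  CyclicSucc-injective (wrap 1+i≡m) (wrap 1+j≡m) = suc-injective (trans 1+i≡m (sym 1+j≡m))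

  CyclicSucc-functional : ∀ {i j k} → CyclicSucc m i j → CyclicSucc m i k → j < m → k < m → j ≡ k
  CyclicSucc-functional step         step         _   _   = refl
  CyclicSucc-functional (wrap _)     (wrap _)     _   _   = refl
  CyclicSucc-functional step         (wrap 1+i≡m) j<m _   = contradiction 1+i≡m (<⇒≢ j<m)
  CyclicSucc-functional (wrap 1+i≡m) step         _   k<m = contradiction 1+i≡m (<⇒≢ k<m)

  CyclicAdj-irreflexive : ∀ {i} → CyclicAdj m i i → m ≤ 1
  CyclicAdj-irreflexive (inj₁ (wrap refl)) = ≤-refl
  CyclicAdj-irreflexive (inj₂ (wrap refl)) = ≤-refl

  CyclicSucc-4-cycle : ∀ {i j k l} → CyclicSucc m i j → CyclicSucc m j k →
                       CyclicSucc m k l → CyclicSucc m l i → m ≤ 4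
  CyclicSucc-4-cycle step        step        step        (wrap refl) = by-decide
  CyclicSucc-4-cycle step        step        (wrap refl) step        = by-decide
  CyclicSucc-4-cycle step        step        (wrap refl) (wrap ())
  CyclicSucc-4-cycle step        (wrap refl) step        step        = by-decide
  CyclicSucc-4-cycle step        (wrap refl) step        (wrap refl) = by-decide
  CyclicSucc-4-cycle step        (wrap refl) (wrap ())   _
  CyclicSucc-4-cycle (wrap refl) step        step        step        = by-decide
  CyclicSucc-4-cycle (wrap refl) step        step        (wrap ())
  CyclicSucc-4-cycle (wrap refl) step        (wrap refl) step        = by-decide
  CyclicSucc-4-cycle (wrap refl) (wrap refl) (wrap refl) (wrap refl) = by-decide

  opposite-neighbours-meet-only-at : 4 < m → ∀ {i j j′ k} → i < m → k < m →
    CyclicSucc m i j → CyclicSucc m j′ i → CyclicAdj m j k → CyclicAdj m j′ k → k ≡ i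
  opposite-neighbours-meet-only-at _   _   _   i→j j′→i (inj₂ k→j) _ = CyclicSucc-injective k→j i→j
  opposite-neighbours-meet-only-at _   i<m k<m i→j j′→i (inj₁ j→k) (inj₁ j′→k) =
    CyclicSucc-functional j′→k j′→i k<m i<m
  opposite-neighbours-meet-only-at 4<m _   _   i→j j′→i (inj₁ j→k) (inj₂ k→j′) =
    contradiction (CyclicSucc-4-cycle i→j j→k k→j′ j′→i) (<⇒≱ 4<m)

even : ℕ → Bool
even zero    = true
even (suc n) = not (even n)

even-2* : ∀ k → even (2 * k) ≡ true
even-2* zero    = refl
even-2* (suc k) = trans (cong (not ∘ even) (+-suc k (k + 0))) (trans (not-involutive _) (even-2* k))

CyclicAdj-even : ∀ {m i j} → even m ≡ true → CyclicAdj m i j → even j ≡ not (even i)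
CyclicAdj-even _      (inj₁ step)         = refl
CyclicAdj-even {i = i} m-even (inj₁ (wrap 1+i≡m)) = sym (trans (cong even 1+i≡m) m-even)
CyclicAdj-even {j = j} _      (inj₂ step)         = sym (not-involutive (even j))
CyclicAdj-even {j = j} m-even (inj₂ (wrap 1+j≡m)) =
  trans (sym (not-involutive (even j))) (cong not (trans (cong even 1+j≡m) m-even))

swap : ℕ → ℕ
swap 0             = 1
swap 1             = 0
swap (suc (suc r)) = suc (suc (swap r))

swap-involutive : ∀ r → swap (swap r) ≡ r
swap-involutive 0             = refl
swap-involutive 1             = refl
swap-involutive (suc (suc r)) = cong (λ r → suc (suc r)) (swap-involutive r)

swap-step : ∀ r → swap r ≡ suc r ⊎ r ≡ suc (swap r)
swap-step 0             = inj₁ refl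
swap-step 1             = inj₂ refl
swap-step (suc (suc r)) with swap-step r
... | inj₁ eq = inj₁ (cong (λ r → suc (suc r)) eq)
... | inj₂ eq = inj₂ (cong (λ r → suc (suc r)) eq)

swap-≢ : ∀ r → swap r ≢ r
swap-≢ r with swap-step r
... | inj₁ eq = λ eq′ → 1+n≢n (trans (sym eq) eq′)
... | inj₂ eq = λ eq′ → 1+n≢n (sym (trans eq (cong suc eq′)))

swap-even : ∀ r → even (swap r) ≡ not (even r)
swap-even 0             = refl
swap-even 1             = refl
swap-even (suc (suc r)) = trans (not-involutive _) (trans (swap-even r) (cong not (sym (not-involutive _))))

swap-adjacent : ∀ m r → CyclicAdj m r (swap r)
swap-adjacent m r with swap-step r
... | inj₁ eq = inj₁ (subst (CyclicSucc m r) (sym eq) step)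
... | inj₂ eq = inj₂ (subst (CyclicSucc m (swap r)) (sym eq) step)

swap-< : ∀ {m r} → even m ≡ true → r < m → swap r < m
swap-< {suc zero}    {zero}        ()     _
swap-< {suc (suc m)} {zero}        _      _               = s≤s (s≤s z≤n)
swap-< {suc m}       {suc zero}    _      1<m             = s≤s z≤n
swap-< {suc (suc m)} {suc (suc r)} m-even (s≤s (s≤s r<m)) =
  s≤s (s≤s (swap-< (trans (sym (not-involutive (even m))) m-even) r<m))

-- Cycle graphs

module _ {m : ℕ} where

  Cycle-adj⇒ : ∀ {i j} → Cycle m ⊢ i ~ j → CyclicAdj m (toℕ i) (toℕ j)
  Cycle-adj⇒ {i} {j} i~j with Equivalence.to T-∨ i~j
  ... | inj₁ i+1≡j = inj₁ (subst (CyclicSucc m _) (≡ᵇ⇒≡ _ _ i+1≡j) step)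
  ... | inj₂ i~j with Equivalence.to T-∨ i~j
  ...   | inj₁ j+1≡i = inj₂ (subst (CyclicSucc m _) (≡ᵇ⇒≡ _ _ j+1≡i) step)
  ...   | inj₂ i~j with Equivalence.to T-∨ i~j
  ...     | inj₁ i≡0∧j+1≡m = let i≡0 , j+1≡m = Equivalence.to T-∧ i≡0∧j+1≡m in
    inj₂ (subst (CyclicSucc m _) (sym (≡ᵇ⇒≡ _ 0 i≡0)) (wrap (≡ᵇ⇒≡ _ _ j+1≡m)))
  ...     | inj₂ j≡0∧i+1≡m = let j≡0 , i+1≡m = Equivalence.to T-∧ j≡0∧i+1≡m in
    inj₁ (subst (CyclicSucc m _) (sym (≡ᵇ⇒≡ _ 0 j≡0)) (wrap (≡ᵇ⇒≡ _ _ i+1≡m)))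

  Cycle-adj⇐ : ∀ {i j} → CyclicAdj m (toℕ i) (toℕ j) → Cycle m ⊢ i ~ j
  Cycle-adj⇐ {i} {j} = adjacent (toℕ i) (toℕ j)
    where
    adjacent : ∀ a b → CyclicAdj m a b →
      T ((suc a ≡ᵇ b) ∨ (suc b ≡ᵇ a) ∨ ((a ≡ᵇ 0) ∧ (suc b ≡ᵇ m)) ∨ ((b ≡ᵇ 0) ∧ (suc a ≡ᵇ m)))
    adjacent a _ (inj₁ step)         = T-∨ˡ (a ≡ᵇ a) (≡⇒≡ᵇ a a refl)
    adjacent _ b (inj₂ step)         = T-∨ʳ (suc (suc b) ≡ᵇ b) (T-∨ˡ (b ≡ᵇ b) (≡⇒≡ᵇ b b refl))
    adjacent a _ (inj₁ (wrap a+1≡m)) = T-∨ʳ (1 ≡ᵇ a) (T-∨ʳ ((a ≡ᵇ 0) ∧ (1 ≡ᵇ m)) (≡⇒≡ᵇ _ _ a+1≡m))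
    adjacent _ b (inj₂ (wrap b+1≡m)) = T-∨ʳ (1 ≡ᵇ b) (T-∨ˡ (suc b ≡ᵇ m) (≡⇒≡ᵇ _ _ b+1≡m))

  forward : Fin m → Fin m → Bool
  forward v w = isYes (CyclicSucc? {m} (toℕ v) (toℕ w))

  forward⇒ : ∀ {v w} → T (forward v w) → CyclicSucc m (toℕ v) (toℕ w)
  forward⇒ = toWitness

  cycleDirections : Directions (Cycle m) 2
  cycleDirections = record
    { Towards  = Towards
    ; unique   = unique
    ; covering = covering
    }
    where
    Towards : Fin m → Fin 2 → Fin m → Bool
    Towards v zero       w = forward v w
    Towards v (suc zero) w = forward w v

    unique : ∀ v k → AtMostOne (Towards v k)
    unique v zero       w w′ v→w v→w′ = FinP.toℕ-injective
      (CyclicSucc-functional (forward⇒ v→w) (forward⇒ v→w′) (FinP.toℕ<n w) (FinP.toℕ<n w′))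
    unique v (suc zero) w w′ w→v w′→v = FinP.toℕ-injective
      (CyclicSucc-injective (forward⇒ w→v) (forward⇒ w′→v))

    covering : ∀ {v w} → Cycle m ⊢ v ~ w → ∃ λ k → T (Towards v k w)
    covering v~w with Cycle-adj⇒ v~w
    ... | inj₁ v→w = zero     , fromWitness v→w
    ... | inj₂ w→v = suc zero , fromWitness w→v

  Cycle-opposite-neighbours : 4 < m → ∀ {v w w′ y} → T (forward v w) → T (forward w′ v) →
                              Cycle m ⊢ w ~ y → Cycle m ⊢ w′ ~ y → y ≡ v
  Cycle-opposite-neighbours 4<m {v} {y = y} v→w w′→v w~y w′~y = FinP.toℕ-injective
    (opposite-neighbours-meet-only-at 4<m (FinP.toℕ<n v) (FinP.toℕ<n y)
      (forward⇒ v→w) (forward⇒ w′→v) (Cycle-adj⇒ w~y) (Cycle-adj⇒ w′~y))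

  cube-in-Cycle : CubeSubgraph d (Cycle m) → d ≤ 2
  cube-in-Cycle cube = dim≤ Function.id (λ _ _ → Function.id)
    where open CubeDirections cycleDirections cube

  cube-in-long-Cycle : 4 < m → CubeSubgraph d (Cycle m) → d ≤ 1
  cube-in-long-Cycle 4<m cube = dim≤ collapse λ i j _ → same-direction i j
    where
    open CubeDirections cycleDirections cube

    opposite : ∀ i j → direction i ≡ zero → direction j ≡ suc zero → ⊥
    opposite i j di dj = far≢origin i≢j (Cycle-opposite-neighbours 4<m
      (subst (λ k → T (Directions.Towards cycleDirections origin k (corner i))) di (towards-corner i))
      (subst (λ k → T (Directions.Towards cycleDirections origin k (corner j))) dj (towards-corner j))
      (corner~far i j) (corner~far′ i j))
      where
      i≢j : i ≢ j
      i≢j refl = contradiction (trans (sym di) dj) λ ()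

    same-direction : ∀ i j → direction i ≡ direction j
    same-direction i j with direction i in di | direction j in dj
    ... | zero     | zero     = refl
    ... | suc zero | suc zero = refl
    ... | zero     | suc zero = ⊥-elim (opposite i j di dj)
    ... | suc zero | zero     = ⊥-elim (opposite j i dj di)

-- Cartesian products

module Product (G H : Graph) where

  private
    V : Set
    V = Fin (N G * N H)

  row : V → Fin (N G)
  row x = proj₁ (remQuot {N G} (N H) x)

  col : V → Fin (N H)
  col x = proj₂ (remQuot {N G} (N H) x)

  row-combine : ∀ (a : Fin (N G)) (b : Fin (N H)) → row (combine a b) ≡ a
  row-combine a b = cong proj₁ (FinP.remQuot-combine a b)

  col-combine : ∀ (a : Fin (N G)) (b : Fin (N H)) → col (combine a b) ≡ b
  col-combine a b = cong proj₂ (FinP.remQuot-combine a b)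

  vertex-≡ : ∀ {x y} → row x ≡ row y → col x ≡ col y → x ≡ y
  vertex-≡ {x} {y} row≡ col≡ = begin
    x                            ≡⟨ FinP.combine-remQuot {N G} (N H) x ⟨
    combine (row x) (col x)      ≡⟨ cong₂ combine row≡ col≡ ⟩
    combine (row y) (col y)      ≡⟨ FinP.combine-remQuot {N G} (N H) y ⟩
    y                            ∎
    where open ≡-Reasoning

  □-adj⇒ : ∀ {x y} → (G □ H) ⊢ x ~ y →
           (row x ≡ row y × H ⊢ col x ~ col y) ⊎ (col x ≡ col y × G ⊢ row x ~ row y)
  □-adj⇒ x~y with Equivalence.to T-∨ x~y
  ... | inj₁ row≡∧col~ = let row≡ , col~ = Equivalence.to T-∧ row≡∧col~ in
    inj₁ (FinP.toℕ-injective (≡ᵇ⇒≡ _ _ row≡) , col~)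
  ... | inj₂ col≡∧row~ = let col≡ , row~ = Equivalence.to T-∧ col≡∧row~ in
    inj₂ (FinP.toℕ-injective (≡ᵇ⇒≡ _ _ col≡) , row~)

  □-adj⇐ : ∀ {x y} → (row x ≡ row y × H ⊢ col x ~ col y) ⊎ (col x ≡ col y × G ⊢ row x ~ row y) →
           (G □ H) ⊢ x ~ y
  □-adj⇐ {x} {y} (inj₁ (row≡ , col~)) =
    T-∨ˡ ((toℕ (row x) ≡ᵇ toℕ (row y)) ∧ adj H (col x) (col y))
         (T-∧⁺ (≡⇒≡ᵇ _ _ (cong toℕ row≡)) col~)
  □-adj⇐ {x} {y} (inj₂ (col≡ , row~)) =
    T-∨ʳ ((toℕ (row x) ≡ᵇ toℕ (row y)) ∧ adj H (col x) (col y))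
         (T-∧⁺ (≡⇒≡ᵇ _ _ (cong toℕ col≡)) row~)

  □-adjʳ : ∀ {a : Fin (N G)} {b b′} → H ⊢ b ~ b′ → (G □ H) ⊢ combine a b ~ combine a b′
  □-adjʳ {a} {b} {b′} b~b′ = □-adj⇐ (inj₁ (trans (row-combine a b) (sym (row-combine a b′)) ,
    subst₂ (H ⊢_~_) (sym (col-combine a b)) (sym (col-combine a b′)) b~b′))

  □-adjˡ : ∀ {a a′} {b : Fin (N H)} → G ⊢ a ~ a′ → (G □ H) ⊢ combine a b ~ combine a′ b
  □-adjˡ {a} {a′} {b} a~a′ = □-adj⇐ (inj₂ (trans (col-combine a b) (sym (col-combine a′ b)) ,
    subst₂ (G ⊢_~_) (sym (row-combine a b)) (sym (row-combine a′ b)) a~a′))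

  module _ (M : PerfectMatching H) where

    open PerfectMatching M

    liftʳ : PerfectMatching (G □ H)
    liftʳ = record
      { mate            = λ x → combine (row x) (mate (col x))
      ; mate-involutive = λ x → vertex-≡
          (trans (row-combine _ _) (row-combine _ _))
          (trans (col-combine _ _) (trans (cong mate (col-combine _ _)) (mate-involutive (col x))))
      ; ~mate           = λ x → □-adj⇐ (inj₁ (sym (row-combine _ _) ,
          subst (H ⊢ col x ~_) (sym (col-combine _ _)) (~mate (col x))))
      ; mate-≢          = λ x eq → mate-≢ (col x) (trans (sym (col-combine _ _)) (cong col eq))
      }

  module _ (M : PerfectMatching G) where

    open PerfectMatching M

    liftˡ : PerfectMatching (G □ H)
    liftˡ = record
      { mate            = λ x → combine (mate (row x)) (col x)
      ; mate-involutive = λ x → vertex-≡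
          (trans (row-combine _ _) (trans (cong mate (row-combine _ _)) (mate-involutive (row x))))
          (trans (col-combine _ _) (col-combine _ _))
      ; ~mate           = λ x → □-adj⇐ (inj₂ (sym (col-combine _ _) ,
          subst (G ⊢ row x ~_) (sym (row-combine _ _)) (~mate (row x))))
      ; mate-≢          = λ x eq → mate-≢ (row x) (trans (sym (row-combine _ _)) (cong row eq))
      }

  □-colouring : ∀ {χ ψ} → ProperColouring G χ → ProperColouring H ψ →
                ProperColouring (G □ H) (λ x → χ (row x) xor ψ (col x))
  □-colouring {χ} {ψ} χ-proper ψ-proper x y x~y with □-adj⇒ x~y
  ... | inj₁ (row≡ , col~) = begin
    χ (row y) xor ψ (col y)          ≡⟨ cong₂ _xor_ (cong χ (sym row≡)) (ψ-proper _ _ col~) ⟩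
    χ (row x) xor not (ψ (col x))    ≡⟨ not-distribʳ-xor (χ (row x)) (ψ (col x)) ⟨
    not (χ (row x) xor ψ (col x))    ∎
    where open ≡-Reasoning
  ... | inj₂ (col≡ , row~) = begin
    χ (row y) xor ψ (col y)          ≡⟨ cong₂ _xor_ (χ-proper _ _ row~) (cong ψ (sym col≡)) ⟩
    not (χ (row x)) xor ψ (col x)    ≡⟨ not-distribˡ-xor (χ (row x)) (ψ (col x)) ⟨
    not (χ (row x) xor ψ (col x))    ∎
    where open ≡-Reasoning

  module □-Directions {Δ Δ′ : ℕ} (DG : Directions G Δ) (DH : Directions H Δ′) where

    private
      module DG = Directions DG
      module DH = Directions DH

    □-towards : V → Fin Δ ⊎ Fin Δ′ → V → Bool
    □-towards x (inj₁ k) y = isYes (col x Fin.≟ col y) ∧ DG.Towards (row x) k (row y)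
    □-towards x (inj₂ k) y = isYes (row x Fin.≟ row y) ∧ DH.Towards (col x) k (col y)

    □-towards-inj₁ : ∀ {x k y} → T (□-towards x (inj₁ k) y) →
                     col x ≡ col y × T (DG.Towards (row x) k (row y))
    □-towards-inj₁ x→y = let col≡ , towards = Equivalence.to T-∧ x→y in toWitness col≡ , towards

    □-towards-inj₂ : ∀ {x k y} → T (□-towards x (inj₂ k) y) →
                     row x ≡ row y × T (DH.Towards (col x) k (col y))
    □-towards-inj₂ x→y = let row≡ , towards = Equivalence.to T-∧ x→y in toWitness row≡ , towards

    □-directions : Directions (G □ H) (Δ + Δ′)
    □-directions = record
      { Towards  = λ x k → □-towards x (splitAt Δ k)
      ; unique   = λ x k → unique x (splitAt Δ k)
      ; covering = covering
      }
      where
      unique : ∀ x k → AtMostOne (□-towards x k)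
      unique x (inj₁ k) y y′ x→y x→y′ =
        let col≡ , towards-y = □-towards-inj₁ x→y ; col≡′ , towards-y′ = □-towards-inj₁ x→y′ in
        vertex-≡ (DG.unique (row x) k _ _ towards-y towards-y′) (trans (sym col≡) col≡′)
      unique x (inj₂ k) y y′ x→y x→y′ =
        let row≡ , towards-y = □-towards-inj₂ x→y ; row≡′ , towards-y′ = □-towards-inj₂ x→y′ in
        vertex-≡ (trans (sym row≡) row≡′) (DH.unique (col x) k _ _ towards-y towards-y′)

      covering : ∀ {x y} → (G □ H) ⊢ x ~ y → ∃ λ k → T (□-towards x (splitAt Δ k) y)
      covering {x} {y} x~y with □-adj⇒ x~y
      ... | inj₁ (row≡ , col~) = let k , towards-y = DH.covering col~ in
        Δ ↑ʳ k , subst (λ s → T (□-towards x s y)) (sym (FinP.splitAt-↑ʳ Δ Δ′ k))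
                       (T-∧⁺ (fromWitness row≡) towards-y)
      ... | inj₂ (col≡ , row~) = let k , towards-y = DG.covering row~ in
        k ↑ˡ Δ′ , subst (λ s → T (□-towards x s y)) (sym (FinP.splitAt-↑ˡ Δ k Δ′))
                        (T-∧⁺ (fromWitness col≡) towards-y)

  open □-Directions public

  square-alongˡ : (∀ {b} → ¬ H ⊢ b ~ b) → ∀ {w₁ w₂ y} → col w₁ ≡ col w₂ → row w₁ ≢ row w₂ →
                  (G □ H) ⊢ w₁ ~ y → (G □ H) ⊢ w₂ ~ y →
                  G ⊢ row w₁ ~ row y × G ⊢ row w₂ ~ row y × col y ≡ col w₁
  square-alongˡ loopless {w₁} {w₂} {y} col≡ row≢ w₁~y w₂~y with □-adj⇒ w₁~y | □-adj⇒ w₂~y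
  ... | inj₂ (col≡₁ , row~₁) | inj₂ (_ , row~₂) = row~₁ , row~₂ , sym col≡₁
  ... | inj₁ (row≡₁ , _)     | inj₁ (row≡₂ , _) = ⊥-elim (row≢ (trans row≡₁ (sym row≡₂)))
  ... | inj₁ (_ , col~₁)     | inj₂ (col≡₂ , _) =
    ⊥-elim (loopless (subst (H ⊢ col w₁ ~_) (trans (sym col≡₂) (sym col≡)) col~₁))
  ... | inj₂ (col≡₁ , _)     | inj₁ (_ , col~₂) =
    ⊥-elim (loopless (subst (H ⊢ col w₂ ~_) (trans (sym col≡₁) col≡) col~₂))

  square-alongʳ : (∀ {a} → ¬ G ⊢ a ~ a) → ∀ {w₁ w₂ y} → row w₁ ≡ row w₂ → col w₁ ≢ col w₂ →
                  (G □ H) ⊢ w₁ ~ y → (G □ H) ⊢ w₂ ~ y →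
                  H ⊢ col w₁ ~ col y × H ⊢ col w₂ ~ col y × row y ≡ row w₁
  square-alongʳ loopless {w₁} {w₂} {y} row≡ col≢ w₁~y w₂~y with □-adj⇒ w₁~y | □-adj⇒ w₂~y
  ... | inj₁ (row≡₁ , col~₁) | inj₁ (_ , col~₂) = col~₁ , col~₂ , sym row≡₁
  ... | inj₂ (col≡₁ , _)     | inj₂ (col≡₂ , _) = ⊥-elim (col≢ (trans col≡₁ (sym col≡₂)))
  ... | inj₂ (_ , row~₁)     | inj₁ (row≡₂ , _) =
    ⊥-elim (loopless (subst (G ⊢ row w₁ ~_) (trans (sym row≡₂) (sym row≡)) row~₁))
  ... | inj₁ (row≡₁ , _)     | inj₂ (_ , row~₂) =
    ⊥-elim (loopless (subst (G ⊢ row w₂ ~_) (trans (sym row≡₁) row≡) row~₂))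

  module □-CubeDirections {Δ Δ′ : ℕ} (DG : Directions G Δ) (DH : Directions H Δ′)
                          (cube : CubeSubgraph d (G □ H)) where

    open CubeDirections (□-directions DG DH) cube public
    private
      module DG = Directions DG
      module DH = Directions DH

    G-edge : ∀ {i k} → splitAt Δ (direction i) ≡ inj₁ k →
             col origin ≡ col (corner i) × T (DG.Towards (row origin) k (row (corner i)))
    G-edge {i} split≡ =
      □-towards-inj₁ DG DH (subst (λ s → T (□-towards DG DH origin s (corner i))) split≡ (towards-corner i))

    H-edge : ∀ {i k} → splitAt Δ (direction i) ≡ inj₂ k →
             row origin ≡ row (corner i) × T (DH.Towards (col origin) k (col (corner i)))
    H-edge {i} split≡ =
      □-towards-inj₂ DG DH (subst (λ s → T (□-towards DG DH origin s (corner i))) split≡ (towards-corner i))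

    dim≤-□ : ∀ {k k′} (mG : Fin Δ → Fin k) (mH : Fin Δ′ → Fin k′) →
             (∀ {i j p q} → splitAt Δ (direction i) ≡ inj₁ p → splitAt Δ (direction j) ≡ inj₁ q →
                            mG p ≡ mG q → p ≡ q) →
             (∀ {i j p q} → splitAt Δ (direction i) ≡ inj₂ p → splitAt Δ (direction j) ≡ inj₂ q →
                            mH p ≡ mH q → p ≡ q) →
             d ≤ k + k′
    dim≤-□ {k} {k′} mG mH G-injective H-injective = dim≤ merge merge-injective
      where
      merge : Fin (Δ + Δ′) → Fin (k + k′)
      merge = join k k′ ∘ Data.Sum.map mG mH ∘ splitAt Δ

      join-injective : ∀ {s s′} → join k k′ s ≡ join k k′ s′ → s ≡ s′
      join-injective {s} {s′} eq =
        trans (sym (FinP.splitAt-join k k′ s)) (trans (cong (splitAt k) eq) (FinP.splitAt-join k k′ s′))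

      splitAt-injective : ∀ {x y} → splitAt Δ x ≡ splitAt Δ y → x ≡ y
      splitAt-injective {x} {y} eq =
        trans (sym (FinP.join-splitAt Δ Δ′ x)) (trans (cong (join Δ Δ′) eq) (FinP.join-splitAt Δ Δ′ y))

      merge-injective : ∀ i j → merge (direction i) ≡ merge (direction j) → direction i ≡ direction j
      merge-injective i j eq = splitAt-injective (same-split (join-injective eq))
        where
        same-split : Data.Sum.map mG mH (splitAt Δ (direction i)) ≡
                     Data.Sum.map mG mH (splitAt Δ (direction j)) →
                     splitAt Δ (direction i) ≡ splitAt Δ (direction j)
        same-split eq′ with splitAt Δ (direction i) in si | splitAt Δ (direction j) in sj | eq′
        ... | inj₁ _ | inj₁ _ | eq″ = cong inj₁ (G-injective si sj (inj₁-injective eq″))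
        ... | inj₂ _ | inj₂ _ | eq″ = cong inj₂ (H-injective si sj (inj₂-injective eq″))
        ... | inj₁ _ | inj₂ _ | ()
        ... | inj₂ _ | inj₁ _ | ()

  □-cube : ∀ {d e} → CubeSubgraph d G → CubeSubgraph e H → CubeSubgraph (d + e) (G □ H)
  □-cube {d} {e} (f , f-injective , f-adjacent) (g , g-injective , g-adjacent) = F , F-injective , F-adjacent
    where
    F : Vec Bool (d + e) → V
    F u = combine (f (Vec.take d u)) (g (Vec.drop d u))

    F-injective : ∀ {u v} → F u ≡ F v → u ≡ v
    F-injective {u} {v} eq = begin
      u                                   ≡⟨ take++drop≡id d u ⟨
      Vec.take d u Vec.++ Vec.drop d u    ≡⟨ cong₂ Vec._++_
                                               (f-injective (FinP.combine-injectiveˡ _ _ _ _ eq))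
                                               (g-injective (FinP.combine-injectiveʳ (f (Vec.take d u)) _ (f (Vec.take d v)) _ eq)) ⟩
      Vec.take d v Vec.++ Vec.drop d v    ≡⟨ take++drop≡id d v ⟩
      v                                   ∎
      where open ≡-Reasoning

    F-adjacent : ∀ u i → (G □ H) ⊢ F u ~ F (flipAt u i)
    F-adjacent u i = subst (λ i′ → (G □ H) ⊢ F u ~ F (flipAt u i′)) (FinP.join-splitAt d e i)
                           (adjacent (splitAt d i))
      where
      adjacent : ∀ s → (G □ H) ⊢ F u ~ F (flipAt u (join d e s))
      adjacent (inj₁ k) = subst₂ (λ a b → (G □ H) ⊢ F u ~ combine (f a) (g b))
        (sym (take-flipAt-↑ˡ d u k)) (sym (drop-flipAt-↑ˡ d u k)) (□-adjˡ (f-adjacent (Vec.take d u) k))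
      adjacent (inj₂ k) = subst₂ (λ a b → (G □ H) ⊢ F u ~ combine (f a) (g b))
        (sym (take-flipAt-↑ʳ d u k)) (sym (drop-flipAt-↑ʳ d u k)) (□-adjʳ (g-adjacent (Vec.drop d u) k))

module LongCycleFactorˡ {m : ℕ} {H : Graph} {Δ′ : ℕ} (DH : Directions H Δ′)
                        (cube : CubeSubgraph d (Cycle m □ H)) where

  open Product (Cycle m) H
  open □-CubeDirections cycleDirections DH cube

  private
    opposite : 4 < m → (∀ {b} → ¬ H ⊢ b ~ b) → ∀ {i j} →
               splitAt 2 (direction i) ≡ inj₁ zero → splitAt 2 (direction j) ≡ inj₁ (suc zero) → ⊥
    opposite 4<m loopless {i} {j} si sj =
      let col-i≡ , i-forward  = G-edge si
          col-j≡ , j-backward = G-edge sj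
          same-col = trans (sym col-i≡) col-j≡
          row≢ = λ row≡ → i≢j (corner-injective (vertex-≡ row≡ same-col))
          i~far , j~far , col-far≡ = square-alongˡ loopless same-col row≢ (corner~far i j) (corner~far′ i j)
      in far≢origin i≢j (vertex-≡ (Cycle-opposite-neighbours 4<m i-forward j-backward i~far j~far)
                                  (trans col-far≡ (sym col-i≡)))
      where
      i≢j : i ≢ j
      i≢j refl = contradiction (trans (sym si) sj) λ ()

  same-cycle-direction : 4 < m → (∀ {b} → ¬ H ⊢ b ~ b) → ∀ {i j p q} →
                         splitAt 2 (direction i) ≡ inj₁ p → splitAt 2 (direction j) ≡ inj₁ q → p ≡ q
  same-cycle-direction _   _        {p = zero}     {zero}     _  _  = refl
  same-cycle-direction _   _        {p = suc zero} {suc zero} _  _  = refl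
  same-cycle-direction 4<m loopless {p = zero}     {suc zero} si sj = ⊥-elim (opposite 4<m loopless si sj)
  same-cycle-direction 4<m loopless {p = suc zero} {zero}     si sj = ⊥-elim (opposite 4<m loopless sj si)

module LongCycleFactorʳ {m : ℕ} {G : Graph} {Δ : ℕ} (DG : Directions G Δ)
                        (cube : CubeSubgraph d (G □ Cycle m)) where

  open Product G (Cycle m)
  open □-CubeDirections DG cycleDirections cube

  private
    opposite : 4 < m → (∀ {a} → ¬ G ⊢ a ~ a) → ∀ {i j} →
               splitAt Δ (direction i) ≡ inj₂ zero → splitAt Δ (direction j) ≡ inj₂ (suc zero) → ⊥
    opposite 4<m loopless {i} {j} si sj =
      let row-i≡ , i-forward  = H-edge si
          row-j≡ , j-backward = H-edge sj
          same-row = trans (sym row-i≡) row-j≡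
          col≢ = λ col≡ → i≢j (corner-injective (vertex-≡ same-row col≡))
          i~far , j~far , row-far≡ = square-alongʳ loopless same-row col≢ (corner~far i j) (corner~far′ i j)
      in far≢origin i≢j (vertex-≡ (trans row-far≡ (sym row-i≡))
                                  (Cycle-opposite-neighbours 4<m i-forward j-backward i~far j~far))
      where
      i≢j : i ≢ j
      i≢j refl = contradiction (trans (sym si) sj) λ ()

  same-cycle-direction : 4 < m → (∀ {a} → ¬ G ⊢ a ~ a) → ∀ {i j p q} →
                         splitAt Δ (direction i) ≡ inj₂ p → splitAt Δ (direction j) ≡ inj₂ q → p ≡ q
  same-cycle-direction _   _        {p = zero}     {zero}     _  _  = refl
  same-cycle-direction _   _        {p = suc zero} {suc zero} _  _  = refl
  same-cycle-direction 4<m loopless {p = zero}     {suc zero} si sj = ⊥-elim (opposite 4<m loopless si sj)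
  same-cycle-direction 4<m loopless {p = suc zero} {zero}     si sj = ⊥-elim (opposite 4<m loopless sj si)

module EvenCycle (n : ℕ) where

  private
    C : Graph
    C = CayleyI2 n

  even-order : even (2 * n) ≡ true
  even-order = even-2* n

  swapᶠ : Fin (2 * n) → Fin (2 * n)
  swapᶠ i = Fin.fromℕ< (swap-< even-order (FinP.toℕ<n i))

  toℕ-swapᶠ : ∀ i → toℕ (swapᶠ i) ≡ swap (toℕ i)
  toℕ-swapᶠ i = FinP.toℕ-fromℕ< _

  matching : PerfectMatching C
  matching = record
    { mate            = swapᶠ
    ; mate-involutive = λ i → FinP.toℕ-injective
        (trans (toℕ-swapᶠ (swapᶠ i)) (trans (cong swap (toℕ-swapᶠ i)) (swap-involutive (toℕ i))))
    ; ~mate           = λ i → Cycle-adj⇐ (subst (CyclicAdj (2 * n) (toℕ i)) (sym (toℕ-swapᶠ i))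
                                                 (swap-adjacent (2 * n) (toℕ i)))
    ; mate-≢          = λ i eq → swap-≢ (toℕ i) (trans (sym (toℕ-swapᶠ i)) (cong toℕ eq))
    }

  parity-colouring : ProperColouring C (even ∘ toℕ)
  parity-colouring i j = CyclicAdj-even even-order ∘ Cycle-adj⇒ {2 * n} {i} {j}

  loopless : ∀ {i} → ¬ C ⊢ i ~ i
  loopless {i} i~i = <⇒≱ (*-monoʳ-≤ 2 (1≤n n i)) (CyclicAdj-irreflexive (Cycle-adj⇒ {2 * n} {i} {i} i~i))
    where
    1≤n : ∀ n → Fin (2 * n) → 1 ≤ n
    1≤n (suc n) _ = s≤s z≤n

  α≡n : IsAlpha C n
  α≡n = colouring⇒IsAlpha parity-colouring refl
    where open PerfectMatchingProperties matching

  more-than-n⇒1≤maxDeg : ∀ K → n < ∣ K ∣ → 1 ≤ maxDeg C K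
  more-than-n⇒1≤maxDeg K n<∣K∣ = N<2*∣K∣⇒1≤maxDeg K (*-monoʳ-< 2 n<∣K∣)
    where open PerfectMatchingProperties matching

-- Meets every pair {2k, 2k+1}, contains {0, 1}, and induces no edges besides {0,1} and {3,4}.
sparse : ℕ → Bool
sparse 0                         = true
sparse 1                         = true
sparse 2                         = false
sparse 3                         = true
sparse (suc (suc (suc (suc r)))) = even r

sparse-meets-pairs : ∀ r → sparse r ≡ true ⊎ sparse (swap r) ≡ true
sparse-meets-pairs 0 = inj₁ refl
sparse-meets-pairs 1 = inj₁ refl
sparse-meets-pairs 2 = inj₂ refl
sparse-meets-pairs 3 = inj₁ refl
sparse-meets-pairs (suc (suc (suc (suc r)))) with even r in even-r
... | true  = inj₁ refl
... | false = inj₂ (trans (swap-even r) (cong not even-r))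

data SparseEdge : ℕ → ℕ → Set where
  0-1 : SparseEdge 0 1
  1-0 : SparseEdge 1 0
  3-4 : SparseEdge 3 4
  4-3 : SparseEdge 4 3

SparseEdge-sym : ∀ {a b} → SparseEdge a b → SparseEdge b a
SparseEdge-sym 0-1 = 1-0
SparseEdge-sym 1-0 = 0-1
SparseEdge-sym 3-4 = 4-3
SparseEdge-sym 4-3 = 3-4

SparseEdge-functional : ∀ {a b b′} → SparseEdge a b → SparseEdge a b′ → b ≡ b′
SparseEdge-functional 0-1 0-1 = refl
SparseEdge-functional 1-0 1-0 = refl
SparseEdge-functional 3-4 3-4 = refl
SparseEdge-functional 4-3 4-3 = refl

module _ {m : ℕ} (6≤m : 6 ≤ m) (even-m : even m ≡ true) where

  private
    short : ∀ {a} → suc a ≡ m → a ≤ 3 → ⊥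
    short a+1≡m a≤3 = <⇒≱ (s≤s (s≤s (m≤n⇒m≤1+n a≤3))) (subst (6 ≤_) (sym a+1≡m) 6≤m)

  sparse-succ : ∀ {a b} → CyclicSucc m a b → sparse a ≡ true → sparse b ≡ true → SparseEdge a b
  sparse-succ {0} step _ _ = 0-1
  sparse-succ {3} step _ _ = 3-4
  sparse-succ {suc (suc (suc (suc r)))} step sa sb =
    contradiction (trans (sym sb) (cong not sa)) λ ()
  sparse-succ {suc (suc (suc (suc r)))} (wrap 5+r≡m) sa _ =
    -- m = 5 + r would be odd
    contradiction (trans (sym (cong (λ b → not (not (not (not (not b))))) sa))
                         (trans (cong even 5+r≡m) even-m)) λ ()
  sparse-succ {1} step _ ()
  sparse-succ {2} step () _
  sparse-succ {0} (wrap 1≡m) _ _ = ⊥-elim (short 1≡m by-decide)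
  sparse-succ {1} (wrap 2≡m) _ _ = ⊥-elim (short 2≡m by-decide)
  sparse-succ {2} (wrap 3≡m) _ _ = ⊥-elim (short 3≡m by-decide)
  sparse-succ {3} (wrap 4≡m) _ _ = ⊥-elim (short 4≡m by-decide)

module LongEvenCycle (n : ℕ) (3≤n : 3 ≤ n) where

  open EvenCycle n

  private
    C : Graph
    C = CayleyI2 n

    6≤2n : 6 ≤ 2 * n
    6≤2n = *-monoʳ-≤ 2 3≤n

    0<2n : 0 < 2 * n
    0<2n = ≤-trans by-decide 6≤2n

    1<2n : 1 < 2 * n
    1<2n = ≤-trans by-decide 6≤2n

    0ᶠ 1ᶠ : Fin (2 * n)
    0ᶠ = Fin.fromℕ< 0<2n
    1ᶠ = Fin.fromℕ< 1<2n

  W : Subset (2 * n)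
  W = tabulate (sparse ∘ toℕ)

  ∈W⁺ : ∀ {v} → sparse (toℕ v) ≡ true → v ∈ W
  ∈W⁺ {v} sv = lookup⇒[]= _ _ (trans (lookup∘tabulate (sparse ∘ toℕ) v) sv)

  ∈W⁻ : ∀ {v} → v ∈ W → sparse (toℕ v) ≡ true
  ∈W⁻ {v} v∈W = trans (sym (lookup∘tabulate (sparse ∘ toℕ) v)) ([]=⇒lookup v∈W)

  n<∣W∣ : n < ∣ W ∣
  n<∣W∣ = *-cancelˡ-< 2 n ∣ W ∣ (meets-every-pair⇒N<2*∣K∣ W meets 0∈W 1∈W)
    where
    open PerfectMatchingProperties matching
    meets : ∀ x → x ∈ W ⊎ swapᶠ x ∈ W
    meets x = Data.Sum.map ∈W⁺ (∈W⁺ ∘ trans (cong sparse (toℕ-swapᶠ x))) (sparse-meets-pairs (toℕ x))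
    0∈W : 0ᶠ ∈ W
    0∈W = ∈W⁺ (cong sparse (FinP.toℕ-fromℕ< 0<2n))
    1∈W : swapᶠ 0ᶠ ∈ W
    1∈W = ∈W⁺ (cong sparse (trans (toℕ-swapᶠ 0ᶠ) (cong swap (FinP.toℕ-fromℕ< 0<2n))))

  maxDeg-W≤1 : maxDeg C W ≤ 1
  maxDeg-W≤1 = maxDeg≤ C λ v v∈W → degIn≤1 C λ w∈W w′∈W v~w v~w′ →
    FinP.toℕ-injective (SparseEdge-functional (edge v∈W w∈W v~w) (edge v∈W w′∈W v~w′))
    where
    edge : ∀ {v w} → v ∈ W → w ∈ W → C ⊢ v ~ w → SparseEdge (toℕ v) (toℕ w)
    edge {v} {w} v∈W w∈W v~w with Cycle-adj⇒ {2 * n} {v} {w} v~w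
    ... | inj₁ v→w = sparse-succ 6≤2n even-order v→w (∈W⁻ v∈W) (∈W⁻ w∈W)
    ... | inj₂ w→v = SparseEdge-sym (sparse-succ 6≤2n even-order w→v (∈W⁻ w∈W) (∈W⁻ v∈W))

  σ≡1 : IsSigma C 1
  σ≡1 = n , α≡n , (W , n<∣W∣ , ≤-antisym maxDeg-W≤1 (more-than-n⇒1≤maxDeg W n<∣W∣)) ,
        more-than-n⇒1≤maxDeg

  κ≡1 : IsKappa C 1
  κ≡1 = edge⇒cube {C} 0≢1 (Cycle-adj⇐ (inj₁ 0→1)) (Cycle-adj⇐ (inj₂ 0→1)) ,
        λ d → cube-in-long-Cycle (≤-trans by-decide 6≤2n)
    where
    0≢1 : 0ᶠ ≢ 1ᶠ
    0≢1 eq = contradiction (trans (sym (FinP.toℕ-fromℕ< 0<2n)) (trans (cong toℕ eq) (FinP.toℕ-fromℕ< 1<2n)))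
                           λ ()
    0→1 : CyclicSucc (2 * n) (toℕ 0ᶠ) (toℕ 1ᶠ)
    0→1 = subst₂ (CyclicSucc (2 * n)) (sym (FinP.toℕ-fromℕ< 0<2n)) (sym (FinP.toℕ-fromℕ< 1<2n)) step

module Square where

  open EvenCycle 2

  private
    C₄ : Graph
    C₄ = CayleyI2 2

  gray : Vec Bool 2 → Fin 4
  gray (false ∷ false ∷ []) = 0F
  gray (true  ∷ false ∷ []) = 1F
  gray (true  ∷ true  ∷ []) = 2F
  gray (false ∷ true  ∷ []) = 3F

  gray⁻¹ : Fin 4 → Vec Bool 2
  gray⁻¹ 0F = false ∷ false ∷ []
  gray⁻¹ 1F = true  ∷ false ∷ []
  gray⁻¹ 2F = true  ∷ true  ∷ []
  gray⁻¹ 3F = false ∷ true  ∷ []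

  gray⁻¹-gray : ∀ u → gray⁻¹ (gray u) ≡ u
  gray⁻¹-gray (false ∷ false ∷ []) = refl
  gray⁻¹-gray (true  ∷ false ∷ []) = refl
  gray⁻¹-gray (true  ∷ true  ∷ []) = refl
  gray⁻¹-gray (false ∷ true  ∷ []) = refl

  gray-adjacent : ∀ u i → C₄ ⊢ gray u ~ gray (flipAt u i)
  gray-adjacent (false ∷ false ∷ []) 0F = tt
  gray-adjacent (false ∷ false ∷ []) 1F = tt
  gray-adjacent (true  ∷ false ∷ []) 0F = tt
  gray-adjacent (true  ∷ false ∷ []) 1F = tt
  gray-adjacent (true  ∷ true  ∷ []) 0F = tt
  gray-adjacent (true  ∷ true  ∷ []) 1F = tt
  gray-adjacent (false ∷ true  ∷ []) 0F = tt
  gray-adjacent (false ∷ true  ∷ []) 1F = tt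

  κ≡2 : IsKappa C₄ 2
  κ≡2 = (gray , gray-injective , gray-adjacent) , λ d → cube-in-Cycle
    where
    gray-injective : ∀ {u v} → gray u ≡ gray v → u ≡ v
    gray-injective {u} {v} eq = trans (sym (gray⁻¹-gray u)) (trans (cong gray⁻¹ eq) (gray⁻¹-gray v))

  reflection : PerfectMatching C₄
  reflection = record
    { mate            = Fin.opposite
    ; mate-involutive = λ { 0F → refl ; 1F → refl ; 2F → refl ; 3F → refl }
    ; ~mate           = λ { 0F → tt ; 1F → tt ; 2F → tt ; 3F → tt }
    ; mate-≢          = λ { 0F () ; 1F () ; 2F () ; 3F () }
    }

  σ≡2 : IsSigma C₄ 2
  σ≡2 = 2 , α≡n , (true ∷ true ∷ true ∷ false ∷ [] , by-decide , refl) , λ K 2<∣K∣ →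
    squares⇒2≤maxDeg matching reflection
      (λ { 0F → refl ; 1F → refl ; 2F → refl ; 3F → refl })
      (λ { 0F () ; 1F () ; 2F () ; 3F () })
      (λ { 0F () ; 1F () ; 2F () ; 3F () })
      K (*-monoʳ-< 2 2<∣K∣)

-- The torus

chequer : ℕ → ℕ → Bool
chequer p q = not (even p xor even q)

-- The chequerboard with the diagonal of its 3 × 3 corner traded for the four cells next to it:
-- one cell more, yet no cell has more than two neighbours in it.
cornered : ℕ → ℕ → Bool
cornered 0 0 = false
cornered 0 1 = true
cornered 1 0 = true
cornered 1 1 = false
cornered 1 2 = true
cornered 2 1 = true
cornered 2 2 = false
cornered p q = chequer p q

CornerCell : Set
CornerCell = Fin 3 × Fin 3

isCell : CornerCell → ℕ → ℕ → Bool
isCell (i , j) p q = (p ≡ᵇ toℕ i) ∧ (q ≡ᵇ toℕ j)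

cellCount : List CornerCell → ℕ → ℕ → ℕ
cellCount []       p q = 0
cellCount (c ∷ cs) p q = 𝟙 (isCell c p q) + cellCount cs p q

cornered-balance : ∀ p q → 𝟙 (cornered p q) + cellCount ((0F , 0F) ∷ (1F , 1F) ∷ (2F , 2F) ∷ []) p q
                         ≡ 𝟙 (chequer p q) + cellCount ((0F , 1F) ∷ (1F , 0F) ∷ (1F , 2F) ∷ (2F , 1F) ∷ []) p q
cornered-balance (suc (suc (suc p))) q = refl
cornered-balance 0 0                   = refl
cornered-balance 0 1                   = refl
cornered-balance 0 2                   = refl
cornered-balance 0 (suc (suc (suc q))) = refl
cornered-balance 1 0                   = refl
cornered-balance 1 1                   = refl
cornered-balance 1 2                   = refl
cornered-balance 1 (suc (suc (suc q))) = refl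
cornered-balance 2 0                   = refl
cornered-balance 2 1                   = refl
cornered-balance 2 2                   = refl
cornered-balance 2 (suc (suc (suc q))) = refl

data TorusStep (A B : ℕ) : Fin 4 → ℕ → ℕ → ℕ → ℕ → Set where
  down  : ∀ {p p′ q} → CyclicSucc A p p′ → TorusStep A B 0F p q p′ q
  up    : ∀ {p p′ q} → CyclicSucc A p′ p → TorusStep A B 1F p q p′ q
  right : ∀ {p q q′} → CyclicSucc B q q′ → TorusStep A B 2F p q p q′
  left  : ∀ {p q q′} → CyclicSucc B q′ q → TorusStep A B 3F p q p q′

⟨_,_⟩ : Fin 4 → Fin 4 → Fin 2 → Fin 4
⟨ k , _ ⟩ 0F = k
⟨ _ , k ⟩ 1F = k

-- Two directions containing every neighbour in `cornered` of a cell of `cornered`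
-- (arbitrary at the other cells).
open-directions : ℕ → ℕ → Fin 2 → Fin 4
open-directions (suc (suc (suc _))) _ = ⟨ 0F , 1F ⟩
open-directions _ (suc (suc (suc _))) = ⟨ 2F , 3F ⟩
open-directions 0 1 = ⟨ 1F , 2F ⟩
open-directions 0 2 = ⟨ 0F , 3F ⟩
open-directions 1 0 = ⟨ 0F , 3F ⟩
open-directions 1 2 = ⟨ 1F , 2F ⟩
open-directions 2 0 = ⟨ 1F , 2F ⟩
open-directions 2 1 = ⟨ 0F , 3F ⟩
open-directions _ _ = ⟨ 0F , 1F ⟩

cornered-row≥3 : ∀ p q → 3 ≤ p → cornered p q ≡ chequer p q
cornered-row≥3 (suc (suc (suc p))) q _               = refl
cornered-row≥3 1                   q (s≤s ())
cornered-row≥3 2                   q (s≤s (s≤s ()))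

cornered-col≥3 : ∀ p q → 3 ≤ q → cornered p q ≡ chequer p q
cornered-col≥3 0                   (suc (suc (suc q))) _ = refl
cornered-col≥3 1                   (suc (suc (suc q))) _ = refl
cornered-col≥3 2                   (suc (suc (suc q))) _ = refl
cornered-col≥3 (suc (suc (suc p))) (suc (suc (suc q))) _ = refl
cornered-col≥3 p                   1                   (s≤s ())
cornered-col≥3 p                   2                   (s≤s (s≤s ()))

module _ {A B : ℕ} (A-even : even A ≡ true) (B-even : even B ≡ true) (4≤A : 4 ≤ A) (4≤B : 4 ≤ B) where

  private
    chequer-row-step : ∀ {p p′} q → CyclicAdj A p p′ → chequer p′ q ≡ not (chequer p q)
    chequer-row-step {p} {p′} q p~p′ = begin
      chequer p′ q                   ≡⟨ cong (λ b → not (b xor even q)) (CyclicAdj-even A-even p~p′) ⟩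
      not (not (even p) xor even q)  ≡⟨ cong not (not-distribˡ-xor (even p) (even q)) ⟨
      not (not (even p xor even q))  ∎
      where open ≡-Reasoning

    chequer-col-step : ∀ p {q q′} → CyclicAdj B q q′ → chequer p q′ ≡ not (chequer p q)
    chequer-col-step p {q} {q′} q~q′ = begin
      chequer p q′                   ≡⟨ cong (λ b → not (even p xor b)) (CyclicAdj-even B-even q~q′) ⟩
      not (even p xor not (even q))  ≡⟨ cong not (not-distribʳ-xor (even p) (even q)) ⟨
      not (not (even p xor even q))  ∎
      where open ≡-Reasoning

    last-row : ∀ {p} q → suc p ≡ A → cornered p q ≡ not (even q)
    last-row {p} q p+1≡A =
      trans (cornered-row≥3 p q (≤-pred (subst (4 ≤_) (sym p+1≡A) 4≤A)))
            (cong (λ b → not (b xor even q))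
                  (trans (sym (not-involutive (even p))) (cong not (trans (cong even p+1≡A) A-even))))

    last-col : ∀ p {q} → suc q ≡ B → cornered p q ≡ not (even p)
    last-col p {q} q+1≡B =
      trans (cornered-col≥3 p q (≤-pred (subst (4 ≤_) (sym q+1≡B) 4≤B)))
            (trans (cong (λ b → not (even p xor b))
                         (trans (sym (not-involutive (even q))) (cong not (trans (cong even q+1≡B) B-even))))
                   (cong not (xor-identityʳ (even p))))

    vertical-blocked : ∀ {p p′ q} → CyclicAdj A p p′ →
                       cornered p (3 + q) ≡ true → cornered p′ (3 + q) ≡ true → ⊥
    vertical-blocked {p} {p′} {q} p~p′ in-v in-w = contradiction (begin
      true                  ≡⟨ in-w ⟨
      cornered p′ (3 + q)   ≡⟨ cornered-col≥3 p′ (3 + q) by-decide ⟩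
      chequer p′ (3 + q)    ≡⟨ chequer-row-step (3 + q) p~p′ ⟩
      not (chequer p (3 + q)) ≡⟨ cong not (trans (sym (cornered-col≥3 p (3 + q) by-decide)) in-v) ⟩
      false                 ∎) λ ()
      where open ≡-Reasoning

    short-A : ∀ {p} → suc p ≡ A → p ≤ 2 → ⊥
    short-A p+1≡A p≤2 = <⇒≱ (s≤s (s≤s p≤2)) (subst (4 ≤_) (sym p+1≡A) 4≤A)

    short-B : ∀ {q} → suc q ≡ B → q ≤ 2 → ⊥
    short-B q+1≡B q≤2 = <⇒≱ (s≤s (s≤s q≤2)) (subst (4 ≤_) (sym q+1≡B) 4≤B)

  cornered-neighbour : ∀ {k p q p′ q′} → TorusStep A B k p q p′ q′ →
                       cornered p q ≡ true → cornered p′ q′ ≡ true → ∃ λ i → open-directions p q i ≡ k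
  cornered-neighbour {p = suc (suc (suc _))} (down _)  _ _ = 0F , refl
  cornered-neighbour {p = suc (suc (suc _))} (up _)    _ _ = 1F , refl
  cornered-neighbour {p = suc (suc (suc p))} {q} (right q→q′) in-v in-w =
    contradiction (trans (sym in-w) (trans (chequer-col-step (3 + p) (inj₁ q→q′)) (cong not in-v))) λ ()
  cornered-neighbour {p = suc (suc (suc p))} {q} (left q′→q) in-v in-w =
    contradiction (trans (sym in-w) (trans (chequer-col-step (3 + p) (inj₂ q′→q)) (cong not in-v))) λ ()
  cornered-neighbour {p = 0} {q = suc (suc (suc _))} (right _) _ _ = 0F , refl
  cornered-neighbour {p = 0} {q = suc (suc (suc _))} (left _)  _ _ = 1F , refl
  cornered-neighbour {p = 1} {q = suc (suc (suc _))} (right _) _ _ = 0F , refl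
  cornered-neighbour {p = 1} {q = suc (suc (suc _))} (left _)  _ _ = 1F , refl
  cornered-neighbour {p = 2} {q = suc (suc (suc _))} (right _) _ _ = 0F , refl
  cornered-neighbour {p = 2} {q = suc (suc (suc _))} (left _)  _ _ = 1F , refl
  cornered-neighbour {p = p} {q = suc (suc (suc q))} (down p→p′) in-v in-w =
    ⊥-elim (vertical-blocked (inj₁ p→p′) in-v in-w)
  cornered-neighbour {p = p} {q = suc (suc (suc q))} (up p′→p) in-v in-w =
    ⊥-elim (vertical-blocked (inj₂ p′→p) in-v in-w)
  cornered-neighbour {p = 0} {1} (up _)       _ _  = 0F , refl
  cornered-neighbour {p = 0} {1} (right _)    _ _  = 1F , refl
  cornered-neighbour {p = 0} {1} (down step)  _ ()
  cornered-neighbour {p = 0} {1} (down (wrap 1≡A)) _ _ = ⊥-elim (short-A 1≡A by-decide)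
  cornered-neighbour {p = 0} {1} (left step)  _ ()
  cornered-neighbour {p = 0} {2} (down _)     _ _  = 0F , refl
  cornered-neighbour {p = 0} {2} (left _)     _ _  = 1F , refl
  cornered-neighbour {p = 0} {2} (up (wrap p′+1≡A)) _ in-w =
    contradiction (trans (sym in-w) (last-row 2 p′+1≡A)) λ ()
  cornered-neighbour {p = 0} {2} (right step) _ ()
  cornered-neighbour {p = 0} {2} (right (wrap 3≡B)) _ _ = ⊥-elim (short-B 3≡B by-decide)
  cornered-neighbour {p = 1} {0} (down _)     _ _  = 0F , refl
  cornered-neighbour {p = 1} {0} (left _)     _ _  = 1F , refl
  cornered-neighbour {p = 1} {0} (up step)    _ ()
  cornered-neighbour {p = 1} {0} (right step) _ ()
  cornered-neighbour {p = 1} {0} (right (wrap 1≡B)) _ _ = ⊥-elim (short-B 1≡B by-decide)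
  cornered-neighbour {p = 1} {2} (up _)       _ _  = 0F , refl
  cornered-neighbour {p = 1} {2} (right _)    _ _  = 1F , refl
  cornered-neighbour {p = 1} {2} (down step)  _ ()
  cornered-neighbour {p = 1} {2} (down (wrap 2≡A)) _ _ = ⊥-elim (short-A 2≡A by-decide)
  cornered-neighbour {p = 1} {2} (left step)  _ ()
  cornered-neighbour {p = 2} {0} (up _)       _ _  = 0F , refl
  cornered-neighbour {p = 2} {0} (right _)    _ _  = 1F , refl
  cornered-neighbour {p = 2} {0} (down step)  _ ()
  cornered-neighbour {p = 2} {0} (down (wrap 3≡A)) _ _ = ⊥-elim (short-A 3≡A by-decide)
  cornered-neighbour {p = 2} {0} (left (wrap q′+1≡B)) _ in-w =
    contradiction (trans (sym in-w) (last-col 2 q′+1≡B)) λ ()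
  cornered-neighbour {p = 2} {1} (down _)     _ _  = 0F , refl
  cornered-neighbour {p = 2} {1} (left _)     _ _  = 1F , refl
  cornered-neighbour {p = 2} {1} (up step)    _ ()
  cornered-neighbour {p = 2} {1} (right step) _ ()
  cornered-neighbour {p = 2} {1} (right (wrap 2≡B)) _ _ = ⊥-elim (short-B 2≡B by-decide)
  cornered-neighbour {p = 0} {0} _ () _
  cornered-neighbour {p = 1} {1} _ () _
  cornered-neighbour {p = 2} {2} _ () _

module Torus (a b : ℕ) where

  open Product (CayleyI2 a) (CayleyI2 b) public
  private
    module A = EvenCycle a
    module B = EvenCycle b
    Tor : Graph
    Tor = CayleyI2×I2 a b

    h u : Fin (N Tor) → Fin (N Tor)
    h = PerfectMatching.mate (liftʳ B.matching)
    u = PerfectMatching.mate (liftˡ A.matching)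

  N≡2*[a*2b] : N Tor ≡ 2 * (a * (2 * b))
  N≡2*[a*2b] = *-assoc 2 a (2 * b)

  chequerᵛ : Fin (N Tor) → Bool
  chequerᵛ x = chequer (toℕ (row x)) (toℕ (col x))

  chequer-colouring : ProperColouring Tor chequerᵛ
  chequer-colouring = not-colouring (□-colouring A.parity-colouring B.parity-colouring)

  α≡a*2b : IsAlpha Tor (a * (2 * b))
  α≡a*2b = colouring⇒IsAlpha chequer-colouring N≡2*[a*2b]
    where open PerfectMatchingProperties (liftʳ B.matching)

  more-than-a*2b⇒2≤maxDeg : ∀ K → a * (2 * b) < ∣ K ∣ → 2 ≤ maxDeg Tor K
  more-than-a*2b⇒2≤maxDeg K lt =
    squares⇒2≤maxDeg (liftʳ B.matching) (liftˡ A.matching) h∘u≡u∘h h≢u x≢h∘u K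
      (subst (_< 2 * ∣ K ∣) (sym N≡2*[a*2b]) (*-monoʳ-< 2 lt))
    where
    col-h : ∀ x → col (h x) ≡ B.swapᶠ (col x)
    col-h x = col-combine _ _
    row-h : ∀ x → row (h x) ≡ row x
    row-h x = row-combine _ _
    col-u : ∀ x → col (u x) ≡ col x
    col-u x = col-combine _ _
    row-u : ∀ x → row (u x) ≡ A.swapᶠ (row x)
    row-u x = row-combine _ _

    h∘u≡u∘h : ∀ x → h (u x) ≡ u (h x)
    h∘u≡u∘h x = vertex-≡
      (trans (row-h (u x)) (trans (row-u x) (sym (trans (row-u (h x)) (cong A.swapᶠ (row-h x))))))
      (trans (col-h (u x)) (trans (cong B.swapᶠ (col-u x)) (sym (trans (col-u (h x)) (col-h x)))))

    h≢u : ∀ x → h x ≢ u x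
    h≢u x eq = PerfectMatching.mate-≢ B.matching (col x) (trans (sym (col-h x)) (trans (cong col eq) (col-u x)))

    x≢h∘u : ∀ x → x ≢ h (u x)
    x≢h∘u x eq = PerfectMatching.mate-≢ B.matching (col x)
      (sym (trans (cong col eq) (trans (col-h (u x)) (cong B.swapᶠ (col-u x)))))

  module _ (cube : CubeSubgraph d Tor) where

    open □-CubeDirections cycleDirections cycleDirections cube
    private
      module L = LongCycleFactorˡ {m = 2 * a} {H = CayleyI2 b} cycleDirections cube
      module R = LongCycleFactorʳ {m = 2 * b} {G = CayleyI2 a} cycleDirections cube

    cube-in-torus : d ≤ 4
    cube-in-torus = dim≤-□ Function.id Function.id (λ _ _ → Function.id) (λ _ _ → Function.id)

    cube-in-torus-longˡ : 4 < 2 * a → d ≤ 3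
    cube-in-torus-longˡ 4<2a = dim≤-□ collapse Function.id
      (λ si sj _ → L.same-cycle-direction 4<2a (λ {i} → B.loopless {i}) si sj) (λ _ _ → Function.id)

    cube-in-torus-longʳ : 4 < 2 * b → d ≤ 3
    cube-in-torus-longʳ 4<2b = dim≤-□ Function.id collapse
      (λ _ _ → Function.id) (λ si sj _ → R.same-cycle-direction 4<2b (λ {i} → A.loopless {i}) si sj)

    cube-in-torus-long : 4 < 2 * a → 4 < 2 * b → d ≤ 2
    cube-in-torus-long 4<2a 4<2b = dim≤-□ collapse collapse
      (λ si sj _ → L.same-cycle-direction 4<2a (λ {i} → B.loopless {i}) si sj)
      (λ si sj _ → R.same-cycle-direction 4<2b (λ {i} → A.loopless {i}) si sj)

  torusDirections : Directions Tor 4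
  torusDirections = □-directions cycleDirections cycleDirections

  open □-Directions cycleDirections cycleDirections
    using () renaming (□-towards-inj₁ to inj₁-towards; □-towards-inj₂ to inj₂-towards)

  step-of : ∀ {v w} k → T (Directions.Towards torusDirections v k w) →
            TorusStep (2 * a) (2 * b) k (toℕ (row v)) (toℕ (col v)) (toℕ (row w)) (toℕ (col w))
  step-of {v} {w} 0F towards = let col≡ , v→w = inj₁-towards {v} {0F} {w} towards in
    subst (TorusStep _ _ 0F _ _ _) (cong toℕ col≡) (down (forward⇒ v→w))
  step-of {v} {w} 1F towards = let col≡ , w→v = inj₁-towards {v} {1F} {w} towards in
    subst (TorusStep _ _ 1F _ _ _) (cong toℕ col≡) (up (forward⇒ w→v))
  step-of {v} {w} 2F towards = let row≡ , v→w = inj₂-towards {v} {0F} {w} towards in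
    subst (λ p′ → TorusStep _ _ 2F _ _ p′ _) (cong toℕ row≡) (right (forward⇒ v→w))
  step-of {v} {w} 3F towards = let row≡ , w→v = inj₂-towards {v} {1F} {w} towards in
    subst (λ p′ → TorusStep _ _ 3F _ _ p′ _) (cong toℕ row≡) (left (forward⇒ w→v))

  module _ (2≤a : 2 ≤ a) (2≤b : 2 ≤ b) where

    private
      r c : Fin (N Tor) → ℕ
      r x = toℕ (row x)
      c x = toℕ (col x)

      4≤2a : 4 ≤ 2 * a
      4≤2a = *-monoʳ-≤ 2 2≤a

      4≤2b : 4 ≤ 2 * b
      4≤2b = *-monoʳ-≤ 2 2≤b

    W : Subset (N Tor)
    W = tabulate λ x → cornered (r x) (c x)

    ∈W⁻ : ∀ {x} → x ∈ W → cornered (r x) (c x) ≡ true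
    ∈W⁻ {x} x∈W = trans (sym (lookup∘tabulate (λ x → cornered (r x) (c x)) x)) ([]=⇒lookup x∈W)

    maxDeg-W≤2 : maxDeg Tor W ≤ 2
    maxDeg-W≤2 = maxDeg≤ Tor λ v v∈W → degIn≤directions torusDirections (open-directions (r v) (c v))
      λ k w∈W _ towards → cornered-neighbour A.even-order B.even-order 4≤2a 4≤2b
                            (step-of k towards) (∈W⁻ v∈W) (∈W⁻ w∈W)

    cellCountᵛ : List CornerCell → Fin (N Tor) → ℕ
    cellCountᵛ cells x = cellCount cells (r x) (c x)

    ∑cellCount : ∀ cells → sum (cellCountᵛ cells) ≡ List.length cells
    ∑cellCount []             = trans (sum-const (N Tor) 0) (*-zeroʳ (N Tor))
    ∑cellCount (cell ∷ cells) =
      trans (∑-distrib-+ (λ x → 𝟙 (isCell cell (r x) (c x))) (cellCountᵛ cells))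
            (cong₂ _+_ (∑isCell cell) (∑cellCount cells))
      where
      ∑isCell : ∀ cell → sum (λ x → 𝟙 (isCell cell (r x) (c x))) ≡ 1
      ∑isCell (i , j) = trans (sum-cong-≗ isCell≡≟z) (∑𝟙≟ z)
        where
        i<2a : toℕ i < 2 * a
        i<2a = ≤-trans (FinP.toℕ<n i) (<⇒≤ 4≤2a)
        j<2b : toℕ j < 2 * b
        j<2b = ≤-trans (FinP.toℕ<n j) (<⇒≤ 4≤2b)
        z : Fin (N Tor)
        z = combine (Fin.fromℕ< i<2a) (Fin.fromℕ< j<2b)
        r-z : r z ≡ toℕ i
        r-z = trans (cong toℕ (row-combine _ _)) (FinP.toℕ-fromℕ< i<2a)
        c-z : c z ≡ toℕ j
        c-z = trans (cong toℕ (col-combine _ _)) (FinP.toℕ-fromℕ< j<2b)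
        isCell≡≟z : ∀ x → 𝟙 (isCell (i , j) (r x) (c x)) ≡ 𝟙 (does (x Fin.≟ z))
        isCell≡≟z x with x Fin.≟ z
        ... | yes refl = cong 𝟙 (Equivalence.to T-≡ (T-∧⁺ (≡⇒≡ᵇ _ _ r-z) (≡⇒≡ᵇ _ _ c-z)))
        ... | no  x≢z with isCell (i , j) (r x) (c x) in x-at
        ...   | false = refl
        ...   | true  = let r≡ , c≡ = Equivalence.to T-∧ (subst T (sym x-at) tt) in
          ⊥-elim (x≢z (vertex-≡ (FinP.toℕ-injective (trans (≡ᵇ⇒≡ _ _ r≡) (sym r-z)))
                                (FinP.toℕ-injective (trans (≡ᵇ⇒≡ _ _ c≡) (sym c-z)))))

    ∣W∣≡1+a*2b : ∣ W ∣ ≡ suc (a * (2 * b))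
    ∣W∣≡1+a*2b = +-cancelʳ-≡ 3 _ _ (begin
      ∣ W ∣ + 3
        ≡⟨ cong₂ _+_ (∣p∣≡∑𝟙 W) (sym (∑cellCount diagonal)) ⟩
      sum (𝟙 ∘ lookup W) + sum (cellCountᵛ diagonal)
        ≡⟨ ∑-distrib-+ (𝟙 ∘ lookup W) (cellCountᵛ diagonal) ⟨
      sum (λ x → 𝟙 (lookup W x) + cellCountᵛ diagonal x)
        ≡⟨ sum-cong-≗ balance ⟩
      sum (λ x → 𝟙 (lookup E x) + cellCountᵛ off-diagonal x)
        ≡⟨ ∑-distrib-+ (𝟙 ∘ lookup E) (cellCountᵛ off-diagonal) ⟩
      sum (𝟙 ∘ lookup E) + sum (cellCountᵛ off-diagonal)
        ≡⟨ cong₂ _+_ (sym (∣p∣≡∑𝟙 E)) (∑cellCount off-diagonal) ⟩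
      ∣ E ∣ + 4
        ≡⟨ cong (_+ 4) ∣E∣≡a*2b ⟩
      a * (2 * b) + 4
        ≡⟨ +-suc (a * (2 * b)) 3 ⟩
      suc (a * (2 * b)) + 3
        ∎)
      where
      open ≡-Reasoning
      open PerfectMatchingProperties (liftʳ B.matching)
      E : Subset (N Tor)
      E = tabulate chequerᵛ
      diagonal off-diagonal : List CornerCell
      diagonal     = (0F , 0F) ∷ (1F , 1F) ∷ (2F , 2F) ∷ []
      off-diagonal = (0F , 1F) ∷ (1F , 0F) ∷ (1F , 2F) ∷ (2F , 1F) ∷ []
      balance : ∀ x → 𝟙 (lookup W x) + cellCountᵛ diagonal x ≡
                      𝟙 (lookup E x) + cellCountᵛ off-diagonal x
      balance x rewrite lookup∘tabulate (λ x → cornered (r x) (c x)) x | lookup∘tabulate chequerᵛ x =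
        cornered-balance (r x) (c x)
      ∣E∣≡a*2b : ∣ E ∣ ≡ a * (2 * b)
      ∣E∣≡a*2b = *-cancelˡ-≡ _ _ 2 (trans (2*∣colour-class∣≡N chequer-colouring) N≡2*[a*2b])

    σ≡2 : IsSigma Tor 2
    σ≡2 = a * (2 * b) , α≡a*2b ,
          (W , a*2b<∣W∣ , ≤-antisym maxDeg-W≤2 (more-than-a*2b⇒2≤maxDeg W a*2b<∣W∣)) ,
          more-than-a*2b⇒2≤maxDeg
      where
      a*2b<∣W∣ : a * (2 * b) < ∣ W ∣
      a*2b<∣W∣ = ≤-reflexive (sym ∣W∣≡1+a*2b)

IsCeilSqrt-unique : ∀ {k s s′} → IsCeilSqrt k s → IsCeilSqrt k s′ → s ≡ s′
IsCeilSqrt-unique (k≤s² , s-least) (k≤s′² , s′-least) = ≤-antisym (s-least _ k≤s′²) (s′-least _ k≤s²)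

⌈√1⌉≡1 : IsCeilSqrt 1 1
⌈√1⌉≡1 = by-decide , λ { zero () ; (suc t) _ → s≤s z≤n }

⌈√k⌉≡2 : ∀ {k} → 2 ≤ k → k ≤ 4 → IsCeilSqrt k 2
⌈√k⌉≡2 2≤k k≤4 = k≤4 , λ
  { 0             k≤0 → contradiction (≤-trans 2≤k k≤0) λ ()
  ; 1             k≤1 → contradiction (≤-trans 2≤k k≤1) λ { (s≤s ()) }
  ; (suc (suc t)) _   → s≤s (s≤s z≤n)
  }

σ≡⌈√κ⌉ : Graph → Set
σ≡⌈√κ⌉ G = Σ ℕ λ k → IsKappa G k × (∀ s → IsCeilSqrt k s → IsSigma G s)

σ≡⌈√κ⌉-intro : ∀ {G κ σ} → IsKappa G κ → IsCeilSqrt κ σ → IsSigma G σ → σ≡⌈√κ⌉ G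
σ≡⌈√κ⌉-intro {G} {κ} κ-proof ⌈√κ⌉ σ-proof =
  κ , κ-proof , λ s ⌈√κ⌉′ → subst (IsSigma G) (IsCeilSqrt-unique ⌈√κ⌉ ⌈√κ⌉′) σ-proof

private
  4<2*[3+k] : ∀ k → 4 < 2 * (3 + k)
  4<2*[3+k] k = ≤-trans by-decide (*-monoʳ-≤ 2 (m≤m+n 3 k))

  Q₂⊆C₄ : CubeSubgraph 2 (CayleyI2 2)
  Q₂⊆C₄ = proj₁ Square.κ≡2

  Q₁⊆C : ∀ k → CubeSubgraph 1 (CayleyI2 (3 + k))
  Q₁⊆C k = proj₁ (LongEvenCycle.κ≡1 (3 + k) (m≤m+n 3 k))

cycle-case : ∀ n → 2 ≤ n → σ≡⌈√κ⌉ (CayleyI2 n)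
cycle-case 1                   (s≤s ())
cycle-case 2                   _ = σ≡⌈√κ⌉-intro Square.κ≡2 (⌈√k⌉≡2 ≤-refl by-decide) Square.σ≡2
cycle-case (suc (suc (suc k))) _ = σ≡⌈√κ⌉-intro κ≡1 ⌈√1⌉≡1 σ≡1
  where open LongEvenCycle (3 + k) (m≤m+n 3 k)

torus-case : ∀ a b → 2 ≤ a → 2 ≤ b → σ≡⌈√κ⌉ (CayleyI2×I2 a b)
torus-case 1 _ (s≤s ()) _
torus-case _ 1 _ (s≤s ())
torus-case 2 2 2≤a 2≤b =
  σ≡⌈√κ⌉-intro (□-cube Q₂⊆C₄ Q₂⊆C₄ , λ _ → cube-in-torus) (⌈√k⌉≡2 by-decide ≤-refl) (σ≡2 2≤a 2≤b)
  where open Torus 2 2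
torus-case 2 (suc (suc (suc l))) 2≤a 2≤b =
  σ≡⌈√κ⌉-intro (□-cube Q₂⊆C₄ (Q₁⊆C l) , λ _ cube → cube-in-torus-longʳ cube (4<2*[3+k] l))
         (⌈√k⌉≡2 by-decide by-decide) (σ≡2 2≤a 2≤b)
  where open Torus 2 (3 + l)
torus-case (suc (suc (suc k))) 2 2≤a 2≤b =
  σ≡⌈√κ⌉-intro (□-cube (Q₁⊆C k) Q₂⊆C₄ , λ _ cube → cube-in-torus-longˡ cube (4<2*[3+k] k))
         (⌈√k⌉≡2 by-decide by-decide) (σ≡2 2≤a 2≤b)
  where open Torus (3 + k) 2
torus-case (suc (suc (suc k))) (suc (suc (suc l))) 2≤a 2≤b =
  σ≡⌈√κ⌉-intro (□-cube (Q₁⊆C k) (Q₁⊆C l) , λ _ cube → cube-in-torus-long cube (4<2*[3+k] k) (4<2*[3+k] l))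
         (⌈√k⌉≡2 ≤-refl by-decide) (σ≡2 2≤a 2≤b)
  where open Torus (3 + k) (3 + l)

theorem6p8 : (n n' : ℕ) → 2 ≤ n → 2 ≤ n' → (G : Graph)
    → (G ≡ CayleyI2 n) ⊎ (G ≡ CayleyI2×I2 n n')
    → Σ ℕ λ k → IsKappa G k × (∀ s → IsCeilSqrt k s → IsSigma G s)
theorem6p8 n n' 2≤n _    _ (inj₁ refl) = cycle-case n 2≤n
theorem6p8 n n' 2≤n 2≤n′ _ (inj₂ refl) = torus-case n n' 2≤n 2≤n′
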